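{- Let $\underline{Rel}$ be equipped with the Seely structure given by the finite-or-countable multiset comonad $\aleph!$ described in the context. For $f:\aleph!X\otimes\aleph!A\to A$ define $$Y^{ind}_{X,A}(f)=\{(w,a)\mid \exists\,\textit{witness}\in\mathrm{RunTree}(f,a)\text{ with no infinite branch},\ w=\mathrm{leaves}(\textit{witness})\},$$ $$Y^{coind}_{X,A}(f)=\{(w,a)\mid \exists\,\textit{witness}\in\mathrm{RunTree}(f,a),\ w=\mathrm{leaves}(\textit{witness})\}.$$ Then both $Y^{ind}$ (the inductive fixpoint operator) and $Y^{coind}$ (the coinductive fixpoint operator) are Conway operators on this Seely category.
   Context: $\underline{Rel}$ has sets of cardinality at most $2^{\aleph_0}$ as objects and binary relations as morphisms, composition $g\circ f=\{(a,c)\mid\exists b,(a,b)\in f,(b,c)\in g\}$; $A\otimes B=A\times B$, $f\otimes g=\{((a,c),(b,d))\mid(a,b)\in f,(c,d)\in g\}$, $1=\{\star\}$; $A\&B=\{(1,a)\}\cup\{(2,b)\}$, $\top=\emptyset$, $\Delta_A=\{(a,(i,a))\mid i\in\{1,2\}\}$. $\aleph!A$ is the set of finite-or-countable multisets over $A$ (functions $A\to\mathbb{N}\cup\{\infty\}$ with finite or countable support), written $[a_1,a_2,\dots]$; $\aleph!f$ relates $[a_1,a_2,\dots]$ to $[b_1,b_2,\dots]$ when $(a_i,b_i)\in f$ for all $i$; $\mathrm{der}_A=\{([a],a)\}$; $\mathrm{dig}_A$ relates $w_1+w_2+\cdots$ to $[w_1,w_2,\dots]$ for every finite or countable family $w_i\in\aleph!A$;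 $m^0=\{(\star,[])\}$; $m_{A,B}$ relates $(w_A,w_B)$ to $(\{1\}\times w_A)+(\{2\}\times w_B)$ where $\{1\}\times[a_1,\dots]=[(1,a_1),\dots]$. Run-trees: for $a\in A$, $\mathrm{RunTree}(f,a)$ is the set of rooted trees (every node at finite depth, each node with finitely or countably many children) labelled by $X\uplus A$, with root labelled $a$, nodes labelled in $X$ being leaves, and every node labelled $b\in A$ satisfying $((u,v),b)\in f$ where $u$ (resp. $v$) is the multiset of $X$-labels (resp. $A$-labels) of its children. $\mathrm{leaves}(\textit{witness})$ is the multiset of labels of $X$-labelled leaves. Conway operator. In a Seely category $\mathscr{C}$ (symmetric monoidal closed, finite products $\&,\top$, comonad $(!,\mathrm{dig},\mathrm{der})$, natural isomorphisms $m_{A,B}:!A\otimes!B\to!(A\&B)$, $m^0:1\to!\top$ with Seely coherences), write $\Delta_X$ for the diagonal and $c_X=m_{X,X}^{ -1}\circ!\Delta_X:!X\to!X\otimes!X$. A Conway operator is a family $Y_{X,A}:\mathscr{C}(!X\otimes!A,A)\to\mathscr{C}(!X,A)$ such that: (1) for $g:!X\to Z$, $f:!Z\otimes!A\to A$: $Y_{X,A}(f\circ((!g\circ\mathrm{dig}_X)\otimes\mathrm{id}_{!A}))=Y_{Z,A}(f)\circ!g\circ\mathrm{dig}_X$; (2) for $f:!X\otimes!A\to A$: $Y_{X,A}(f)=f\circ(\mathrm{id}_{!X}\otimes(!Y_{X,A}(f)\circ\mathrm{dig}_X))\circ c_X$; (3) for $f:!X\otimes!B\to A$, $g:!X\otimes!A\to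 B$, with $f\star g=f\circ(\mathrm{id}_{!X}\otimes!(g\circ m_{X,A}^{ -1}))\circ(\mathrm{id}_{!X}\otimes\mathrm{dig}_{X\&A})\circ(\mathrm{id}_{!X}\otimes m_{X,A})\circ(c_X\otimes\mathrm{id}_{!A})$: $Y_{X,A}(f\star g)=f\circ(\mathrm{id}_{!X}\otimes(!Y_{X,B}(g\star f)\circ\mathrm{dig}_X))\circ c_X$; (4) for $f:!X\otimes!A\otimes!A\to A$: $Y_{X,A}(Y_{X\&A,A}(f\circ(m_{X,A}^{ -1}\otimes\mathrm{id}_{!A}))\circ m_{X,A})=Y_{X,A}(f\circ(\mathrm{id}_{!X}\otimes(m_{A,A}^{ -1}\circ!\Delta_A)))$. Here $!$ is $\aleph!$. -}

module Defs where

-- Objects are presented as setoids (a set = carrier modulo an equivalence),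
-- so that quotient objects such as !A (multisets = families up to
-- reindexing) are objects on the same footing as base sets.

open import Level using (0ℓ) renaming (suc to lsuc)
open import Data.Nat using (ℕ)
open import Data.Bool using (Bool)
open import Data.Empty.Polymorphic using (⊥)
open import Data.Product using (Σ; _×_; _,_; proj₁; proj₂)
open import Data.Sum using (_⊎_; inj₁; inj₂; [_,_]′)
open import Function using (_∘_)
open import Function.Bundles using (_↔_; Inverse)
open import Relation.Binary.Bundles using (Setoid)
open import Relation.Binary.PropositionalEquality using (_≡_)

ℓ₁ = lsuc 0ℓ

record Obj : Set₂ where
  field
    Car : Set₁
    _≈_ : Car → Car → Set₁
open Obj public

Countable : Set → Set
Countable I = Σ (I → ℕ) λ e → ∀ {i j} → e i ≡ e j → i ≡ j

-- A set of cardinality at most 2^ℵ₀: a setoid whose quotient injects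
-- into ℕ → Bool.
Small : Setoid ℓ₁ ℓ₁ → Set₁
Small S = Σ (Setoid.Carrier S → ℕ → Bool) λ e →
  ∀ x y → (Setoid._≈_ S x y → ∀ n → e x n ≡ e y n)
        × ((∀ n → e x n ≡ e y n) → Setoid._≈_ S x y)

record SmallObj : Set₂ where
  field
    setoid : Setoid ℓ₁ ℓ₁
    small  : Small setoid

⌊_⌋ : SmallObj → Obj
⌊ S ⌋ = record { Car = Setoid.Carrier (SmallObj.setoid S)
               ; _≈_ = Setoid._≈_ (SmallObj.setoid S) }

-- finite-or-countable multisets: countably indexed families
record MSet (C : Set₁) : Set₁ where
  field
    Idx : Set
    cnt : Countable Idx
    lab : Idx → C
open MSet public

_⊗_ : Obj → Obj → Obj
A ⊗ B = record { Car = Car A × Car B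
               ; _≈_ = λ p q → _≈_ A (proj₁ p) (proj₁ q) × _≈_ B (proj₂ p) (proj₂ q) }

sumEq : (A B : Obj) → Car A ⊎ Car B → Car A ⊎ Car B → Set₁
sumEq A B (inj₁ a) (inj₁ a') = _≈_ A a a'
sumEq A B (inj₁ a) (inj₂ b') = ⊥
sumEq A B (inj₂ b) (inj₁ a') = ⊥
sumEq A B (inj₂ b) (inj₂ b') = _≈_ B b b'

-- cartesian product A & B (disjoint union in Rel)
_&_ : Obj → Obj → Obj
A & B = record { Car = Car A ⊎ Car B ; _≈_ = sumEq A B }

MsEq : (A : Obj) → MSet (Car A) → MSet (Car A) → Set₁
MsEq A u v = Σ (Idx u ↔ Idx v) λ σ → ∀ i → _≈_ A (lab u i) (lab v (Inverse.to σ i))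

! : Obj → Obj
! A = record { Car = MSet (Car A) ; _≈_ = MsEq A }

record Hom (A B : Obj) : Set₂ where
  constructor mk
  field
    R : Car A → Car B → Set₁
open Hom public

-- a relation is a morphism between the quotient sets
IsMor : {A B : Obj} → Hom A B → Set₁
IsMor {A} {B} f = ∀ {a a' b b'} → _≈_ A a a' → _≈_ B b b' → R f a b → R f a' b'

_≐_ : {A B : Obj} → Hom A B → Hom A B → Set₁
_≐_ {A} {B} f g = ∀ a b → (R f a b → R g a b) × (R g a b → R f a b)

idₕ : (A : Obj) → Hom A A
idₕ A = mk (_≈_ A)

infixr 9 _∘ₕ_
_∘ₕ_ : {A B C : Obj} → Hom B C → Hom A B → Hom A C
_∘ₕ_ {B = B} g f = mk λ a c → Σ (Car B) λ b → R f a b × R g b c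

infixr 10 _⊗ₕ_
_⊗ₕ_ : {A B C D : Obj} → Hom A B → Hom C D → Hom (A ⊗ C) (B ⊗ D)
f ⊗ₕ g = mk λ p q → R f (proj₁ p) (proj₁ q) × R g (proj₂ p) (proj₂ q)

converse : {A B : Obj} → Hom A B → Hom B A
converse f = mk λ b a → R f a b

α : (A B C : Obj) → Hom ((A ⊗ B) ⊗ C) (A ⊗ (B ⊗ C))
α A B C = mk λ p q → _≈_ (A ⊗ (B ⊗ C)) (proj₁ (proj₁ p) , (proj₂ (proj₁ p) , proj₂ p)) q

α⁻¹ : (A B C : Obj) → Hom (A ⊗ (B ⊗ C)) ((A ⊗ B) ⊗ C)
α⁻¹ A B C = converse (α A B C)

!ₕ : {A B : Obj} → Hom A B → Hom (! A) (! B)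
!ₕ f = mk λ u v → Σ (Idx u ↔ Idx v) λ σ → ∀ i → R f (lab u i) (lab v (Inverse.to σ i))

-- dig relates w₁ + w₂ + ⋯ to [w₁ , w₂ , ⋯]
dig : (A : Obj) → Hom (! A) (! (! A))
dig A = mk λ w W →
  Σ (Idx w ↔ Σ (Idx W) (λ j → Idx (lab W j))) λ σ →
    ∀ k → _≈_ A (lab w k) (lab (lab W (proj₁ (Inverse.to σ k))) (proj₂ (Inverse.to σ k)))

der : (A : Obj) → Hom (! A) A
der A = mk λ w a → Σ (Idx w ↔ Data.Unit.⊤) λ _ → ∀ i → _≈_ A (lab w i) a
  where import Data.Unit

m : (A B : Obj) → Hom (! A ⊗ ! B) (! (A & B))
m A B = mk λ p w →
  Σ (Idx w ↔ (Idx (proj₁ p) ⊎ Idx (proj₂ p))) λ σ →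
    ∀ k → sumEq A B (lab w k) ([ inj₁ ∘ lab (proj₁ p) , inj₂ ∘ lab (proj₂ p) ]′ (Inverse.to σ k))

m⁻¹ : (A B : Obj) → Hom (! (A & B)) (! A ⊗ ! B)
m⁻¹ A B = converse (m A B)

Δ : (A : Obj) → Hom A (A & A)
Δ A = mk λ a e → sumEq A A e (inj₁ a) ⊎ sumEq A A e (inj₂ a)

c : (X : Obj) → Hom (! X) (! X ⊗ ! X)
c X = m⁻¹ X X ∘ₕ !ₕ (Δ X)

Op : Set₂
Op = (X A : Obj) → Hom (! X ⊗ ! A) A → Hom (! X) A

star : (X A B : Obj) → Hom (! X ⊗ ! B) A → Hom (! X ⊗ ! A) B → Hom (! X ⊗ ! A) A
star X A B f g =
  f ∘ₕ (idₕ (! X) ⊗ₕ !ₕ (g ∘ₕ m⁻¹ X A))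
    ∘ₕ (idₕ (! X) ⊗ₕ dig (X & A))
    ∘ₕ (idₕ (! X) ⊗ₕ m X A)
    ∘ₕ α (! X) (! X) (! A)
    ∘ₕ (c X ⊗ₕ idₕ (! A))

record IsConway (Y : Op) : Set₃ where
  field
    preserves-mor : (X A : SmallObj) (f : Hom (! ⌊ X ⌋ ⊗ ! ⌊ A ⌋) ⌊ A ⌋) →
      IsMor f → IsMor (Y ⌊ X ⌋ ⌊ A ⌋ f)
    preserves-eq : (X A : SmallObj) (f f' : Hom (! ⌊ X ⌋ ⊗ ! ⌊ A ⌋) ⌊ A ⌋) →
      IsMor f → IsMor f' → f ≐ f' → Y ⌊ X ⌋ ⌊ A ⌋ f ≐ Y ⌊ X ⌋ ⌊ A ⌋ f'
    law1 : (X Z A : SmallObj) (g : Hom (! ⌊ X ⌋) ⌊ Z ⌋) (f : Hom (! ⌊ Z ⌋ ⊗ ! ⌊ A ⌋) ⌊ A ⌋) →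
      IsMor g → IsMor f →
      Y ⌊ X ⌋ ⌊ A ⌋ (f ∘ₕ ((!ₕ g ∘ₕ dig ⌊ X ⌋) ⊗ₕ idₕ (! ⌊ A ⌋)))
        ≐ (Y ⌊ Z ⌋ ⌊ A ⌋ f ∘ₕ !ₕ g ∘ₕ dig ⌊ X ⌋)
    law2 : (X A : SmallObj) (f : Hom (! ⌊ X ⌋ ⊗ ! ⌊ A ⌋) ⌊ A ⌋) → IsMor f →
      Y ⌊ X ⌋ ⌊ A ⌋ f
        ≐ (f ∘ₕ (idₕ (! ⌊ X ⌋) ⊗ₕ (!ₕ (Y ⌊ X ⌋ ⌊ A ⌋ f) ∘ₕ dig ⌊ X ⌋)) ∘ₕ c ⌊ X ⌋)
    law3 : (X A B : SmallObj) (f : Hom (! ⌊ X ⌋ ⊗ ! ⌊ B ⌋) ⌊ A ⌋)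
      (g : Hom (! ⌊ X ⌋ ⊗ ! ⌊ A ⌋) ⌊ B ⌋) → IsMor f → IsMor g →
      Y ⌊ X ⌋ ⌊ A ⌋ (star ⌊ X ⌋ ⌊ A ⌋ ⌊ B ⌋ f g)
        ≐ (f ∘ₕ (idₕ (! ⌊ X ⌋) ⊗ₕ (!ₕ (Y ⌊ X ⌋ ⌊ B ⌋ (star ⌊ X ⌋ ⌊ B ⌋ ⌊ A ⌋ g f)) ∘ₕ dig ⌊ X ⌋))
             ∘ₕ c ⌊ X ⌋)
    law4 : (X A : SmallObj) (f : Hom ((! ⌊ X ⌋ ⊗ ! ⌊ A ⌋) ⊗ ! ⌊ A ⌋) ⌊ A ⌋) → IsMor f →
      Y ⌊ X ⌋ ⌊ A ⌋ (Y (⌊ X ⌋ & ⌊ A ⌋) ⌊ A ⌋ (f ∘ₕ (m⁻¹ ⌊ X ⌋ ⌊ A ⌋ ⊗ₕ idₕ (! ⌊ A ⌋)))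
                      ∘ₕ m ⌊ X ⌋ ⌊ A ⌋)
        ≐ Y ⌊ X ⌋ ⌊ A ⌋ (f ∘ₕ α⁻¹ (! ⌊ X ⌋) (! ⌊ A ⌋) (! ⌊ A ⌋)
                           ∘ₕ (idₕ (! ⌊ X ⌋) ⊗ₕ (m⁻¹ ⌊ A ⌋ ⌊ A ⌋ ∘ₕ !ₕ (Δ ⌊ A ⌋))))

-- Run-trees.  A node labelled b ∈ A has a countable multiset u of
-- X-labelled (leaf) children and a countable multiset v of A-labelled
-- children, with ((u , v) , b) ∈ f.

module RunTrees (X A : Obj) (f : Hom (! X ⊗ ! A) A) where

  data Tree : Car A → Set₁ where
    node : ∀ {b} (u : MSet (Car X)) (v : MSet (Car A)) → R f (u , v) b →
           ((i : Idx v) → Tree (lab v i)) → Tree b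

  data Leaf : ∀ {b} → Tree b → Set₁ where
    here  : ∀ {b u v p ts} → Idx u → Leaf (node {b} u v p ts)
    there : ∀ {b u v p ts} (i : Idx v) → Leaf (ts i) → Leaf (node {b} u v p ts)

  leafLab : ∀ {b} {t : Tree b} → Leaf t → Car X
  leafLab (here {u = u} k) = lab u k
  leafLab (there i l) = leafLab l

  -- arbitrary run-trees (possibly infinite branches; every node at finite
  -- depth), presented as the unfolding of a pointed coalgebra: the nodes of
  -- the tree are the finite paths from the root state.
  record CoTree (b : Car A) : Set₁ where
    field
      St       : Set
      root     : St
      lbl      : St → Car A
      root-lbl : lbl root ≡ b
      xs       : St → MSet (Car X)
      as       : St → MSet (Car A)
      ok       : ∀ s → R f (xs s , as s) (lbl s)
      sub      : ∀ s → Idx (as s) → St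
      sub-lbl  : ∀ s i → lbl (sub s i) ≡ lab (as s) i

  module _ {b : Car A} (t : CoTree b) where
    open CoTree t

    data CoLeafFrom : St → Set where
      here  : ∀ {s} → Idx (xs s) → CoLeafFrom s
      there : ∀ {s} (i : Idx (as s)) → CoLeafFrom (sub s i) → CoLeafFrom s

    coLeafLabFrom : ∀ {s} → CoLeafFrom s → Car X
    coLeafLabFrom (here {s} k) = lab (xs s) k
    coLeafLabFrom (there i l) = coLeafLabFrom l

    CoLeaf : Set
    CoLeaf = CoLeafFrom root

    coLeafLab : CoLeaf → Car X
    coLeafLab = coLeafLabFrom

Yind : Op
Yind X A f = mk λ w a → Σ (Tree a) λ t → Σ (Idx w ↔ Leaf t) λ σ →
    ∀ k → _≈_ X (lab w k) (leafLab (Inverse.to σ k))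
  where open RunTrees X A f

Ycoind : Op
Ycoind X A f = mk λ w a → Σ (CoTree a) λ t → Σ (Idx w ↔ CoLeaf t) λ σ →
    ∀ k → _≈_ X (lab w k) (coLeafLab t (Inverse.to σ k))
  where open RunTrees X A f

-- Both fixpoints are read off run-trees, and each Conway law is witnessed by an
-- explicit transformation of run-trees that preserves the multiset of leaves.
-- Law (2) unfolds the root of a run-tree, or grafts run-trees under a new root.
-- Law (1) trades each node of an (f ∘ (!g ∘ dig) ⊗ id)-tree for an f-node whose
-- X-leaves carry g-witnesses. Law (3): a node of an (f ⋆ g)-tree is an f-node over
-- g-nodes, so regrouping the layers turns it into one f-node over (g ⋆ f)-trees.
-- Law (4): a node of the nested fixpoint carries a whole inner run-tree; splicing
-- these inner trees into the outer one gives a run-tree of the diagonal, and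
-- conversely the maximal segments reached through second-copy children are the
-- inner trees.
--
-- Multisets are countable families and two multisets are equal when a bijection of
-- the index sets relates the labels, so every law comes down to building index
-- bijections. Well-founded run-trees are treated by structural recursion; arbitrary
-- run-trees are pointed transition systems whose leaves are the finite paths to
-- X-labels, so in the coinductive case one builds new transition systems together
-- with bijections between their sets of paths.

module Submission where

open import Data.Empty using (⊥; ⊥-elim)
open import Data.Nat using (ℕ; zero; suc; _*_)
open import Data.Nat.Properties using (suc-injective; *-cancelˡ-≡; even≢odd)
import Data.Product as Product
open import Data.Product using (Σ; _×_; _,_; proj₁; proj₂)
open import Data.Product.Algebra using (Σ-assoc-alt)
open import Data.Product.Function.Dependent.Propositional using (Σ-↔)
import Data.Sum as Sum
open import Data.Sum using (_⊎_; inj₁; inj₂; [_,_]′)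
open import Data.Sum.Algebra using (⊎-cong; ⊎-assoc)
open import Data.Sum.Properties using (inj₁-injective; inj₂-injective)
open import Data.Unit using (⊤; tt)
open import Function using (_∘_)
open import Function.Bundles using (_↔_; Inverse; mk↔ₛ′)
open import Function.Properties.Inverse using (↔-refl; ↔-sym; ↔-trans)
open import Level using (0ℓ)
open import Relation.Binary.Bundles using (Setoid)
open import Relation.Binary.PropositionalEquality using (_≡_; refl; sym; trans; cong; subst)
open import Relation.Binary.Structures using (IsEquivalence)

open import Defs

open Inverse using (to; from; strictlyInverseˡ; strictlyInverseʳ)

parity : ℕ ⊎ ℕ → ℕ
parity (inj₁ m) = 2 * m
parity (inj₂ n) = suc (2 * n)

parity-injective : ∀ {x y} → parity x ≡ parity y → x ≡ y
parity-injective {inj₁ m} {inj₁ n} e = cong inj₁ (*-cancelˡ-≡ m n 2 e)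
parity-injective {inj₁ m} {inj₂ n} e = ⊥-elim (even≢odd m n e)
parity-injective {inj₂ m} {inj₁ n} e = ⊥-elim (even≢odd n m (sym e))
parity-injective {inj₂ m} {inj₂ n} e = cong inj₂ (*-cancelˡ-≡ m n 2 (suc-injective e))

pair : ℕ → ℕ → ℕ
pair zero    n = parity (inj₁ n)
pair (suc m) n = parity (inj₂ (pair m n))

pair-injective : ∀ m n m′ n′ → pair m n ≡ pair m′ n′ → m ≡ m′ × n ≡ n′
pair-injective zero    n zero     n′ e = refl , inj₁-injective (parity-injective e)
pair-injective zero    n (suc m′) n′ e = ⊥-elim (even≢odd n (pair m′ n′) e)
pair-injective (suc m) n zero     n′ e = ⊥-elim (even≢odd n′ (pair m n) (sym e))
pair-injective (suc m) n (suc m′) n′ e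
  with refl , refl ← pair-injective m n m′ n′ (inj₂-injective (parity-injective e)) = refl , refl

opaque
  countable-⊎ : ∀ {A B} → Countable A → Countable B → Countable (A ⊎ B)
  countable-⊎ (ea , ia) (eb , ib) = parity ∘ Sum.map ea eb , injective
    where
    injective : ∀ {x y} → parity (Sum.map ea eb x) ≡ parity (Sum.map ea eb y) → x ≡ y
    injective {inj₁ x} {inj₁ y} e = cong inj₁ (ia (inj₁-injective (parity-injective e)))
    injective {inj₁ x} {inj₂ y} e = ⊥-elim (even≢odd (ea x) (eb y) e)
    injective {inj₂ x} {inj₁ y} e = ⊥-elim (even≢odd (ea y) (eb x) (sym e))
    injective {inj₂ x} {inj₂ y} e = cong inj₂ (ib (inj₂-injective (parity-injective e)))

  countable-Σ : ∀ {I} {P : I → Set} → Countable I → (∀ i → Countable (P i)) → Countable (Σ I P)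
  countable-Σ {I} {P} (ei , ii) cp = code , injective
    where
    code : Σ I P → ℕ
    code (i , x) = pair (ei i) (proj₁ (cp i) x)
    injective : ∀ {p q} → code p ≡ code q → p ≡ q
    injective {i , x} {j , y} e with pair-injective _ _ _ _ e
    ... | ei≡ej , cx≡cy with ii ei≡ej
    ... | refl = cong (i ,_) (proj₂ (cp i) cx≡cy)

mset : ∀ {C : Set₁} (I : Set) → Countable I → (I → C) → MSet C
mset I c l = record { Idx = I ; cnt = c ; lab = l }

infixr 6 _⊕_
_⊕_ : ∀ {C : Set₁} → MSet C → MSet C → MSet C
u ⊕ v = mset (Idx u ⊎ Idx v) (countable-⊎ (cnt u) (cnt v)) [ lab u , lab v ]′

ΣM : ∀ {C : Set₁} (I : Set) → Countable I → (I → MSet C) → MSet C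
ΣM I c F = mset (Σ I (λ i → Idx (F i))) (countable-Σ c (λ i → cnt (F i))) (λ p → lab (F (proj₁ p)) (proj₂ p))

⨁ : ∀ {C : Set₁} → MSet (MSet C) → MSet C
⨁ W = ΣM (Idx W) (cnt W) (lab W)

mapM : ∀ {C D : Set₁} → (C → D) → MSet C → MSet D
mapM f u = mset (Idx u) (cnt u) (λ i → f (lab u i))

middle-swap : ∀ {A B C D : Set} → (A ⊎ B) ⊎ (C ⊎ D) → (A ⊎ C) ⊎ (B ⊎ D)
middle-swap = [ Sum.map inj₁ inj₁ , Sum.map inj₂ inj₂ ]′

middle-swap-involutive : ∀ {A B C D : Set} (x : (A ⊎ B) ⊎ (C ⊎ D)) → middle-swap (middle-swap x) ≡ x
middle-swap-involutive (inj₁ (inj₁ x)) = refl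
middle-swap-involutive (inj₁ (inj₂ x)) = refl
middle-swap-involutive (inj₂ (inj₁ x)) = refl
middle-swap-involutive (inj₂ (inj₂ x)) = refl

⊎-interchange : ∀ {A B C D : Set} → ((A ⊎ B) ⊎ (C ⊎ D)) ↔ ((A ⊎ C) ⊎ (B ⊎ D))
⊎-interchange = mk↔ₛ′ middle-swap middle-swap middle-swap-involutive middle-swap-involutive

Σ-distribˡ-⊎ : ∀ {I : Set} {P Q : I → Set} → Σ I (λ i → P i ⊎ Q i) ↔ (Σ I P ⊎ Σ I Q)
Σ-distribˡ-⊎ = mk↔ₛ′ (λ { (i , x) → Sum.map (i ,_) (i ,_) x }) [ Product.map₂ inj₁ , Product.map₂ inj₂ ]′
  (λ { (inj₁ _) → refl ; (inj₂ _) → refl }) λ { (i , inj₁ x) → refl ; (i , inj₂ y) → refl }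

Σ-distribʳ-⊎ : ∀ {I J : Set} {P : I ⊎ J → Set} → Σ (I ⊎ J) P ↔ (Σ I (P ∘ inj₁) ⊎ Σ J (P ∘ inj₂))
Σ-distribʳ-⊎ = mk↔ₛ′ (λ { (inj₁ i , x) → inj₁ (i , x) ; (inj₂ j , x) → inj₂ (j , x) })
  (λ { (inj₁ (i , x)) → inj₁ i , x ; (inj₂ (j , x)) → inj₂ j , x })
  (λ { (inj₁ _) → refl ; (inj₂ _) → refl }) λ { (inj₁ i , x) → refl ; (inj₂ j , x) → refl }

record Lift {C D : Set₁} (R : C → D → Set₁) (u : MSet C) (v : MSet D) : Set₁ where
  constructor _,_
  field
    bij : Idx u ↔ Idx v
    lbl : ∀ i → R (lab u i) (lab v (Inverse.to bij i))
open Lift public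

Σ⇒Lift : ∀ {C D : Set₁} {R : C → D → Set₁} {u v} →
      Σ (Idx u ↔ Idx v) (λ σ → ∀ i → R (lab u i) (lab v (Inverse.to σ i))) → Lift R u v
Σ⇒Lift (σ , h) = σ , h

Lift⇒Σ : ∀ {C D : Set₁} {R : C → D → Set₁} {u v} →
      Lift R u v → Σ (Idx u ↔ Idx v) (λ σ → ∀ i → R (lab u i) (lab v (Inverse.to σ i)))
Lift⇒Σ (σ , h) = σ , h

module _ {C D : Set₁} {R : C → D → Set₁} where
  Lift-from : ∀ {u v} (p : Lift R u v) → ∀ j → R (lab u (from (bij p) j)) (lab v j)
  Lift-from {u} {v} (σ , h) j = subst (λ z → R (lab u (from σ j)) (lab v z)) (strictlyInverseˡ σ j) (h (from σ j))

  Lift-⊕ : ∀ {u u' v v'} → Lift R u u' → Lift R v v' → Lift R (u ⊕ v) (u' ⊕ v')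
  Lift-⊕ (σ , h) (τ , k) = ⊎-cong σ τ , λ { (inj₁ x) → h x ; (inj₂ y) → k y }

  Lift-ΣM : ∀ {I J c d F G} (σ : I ↔ J) → (∀ i → Lift R (F i) (G (to σ i))) →
        Lift R (ΣM I c F) (ΣM J d G)
  Lift-ΣM σ h = Σ-↔ σ (λ {i} → bij (h i)) , λ { (i , x) → lbl (h i) x }

  Lift-ΣM′ : ∀ {I c F G} → (∀ i → Lift R (F i) (G i)) → Lift R (ΣM I c F) (ΣM I c G)
  Lift-ΣM′ {I} {c} {F} {G} h = Lift-ΣM {c = c} {d = c} {F = F} {G = G} ↔-refl h

module _ {C D : Set₁} {R : C → D → Set₁} {S : D → C → Set₁} where
  Lift-sym : (∀ {a b} → R a b → S b a) → ∀ {u v} → Lift R u v → Lift S v u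
  Lift-sym f p = ↔-sym (bij p) , λ j → f (Lift-from p j)

module _ {C D E : Set₁} {R : C → D → Set₁} {S : D → E → Set₁} {T : C → E → Set₁} where
  Lift-trans : (∀ {a b c} → R a b → S b c → T a c) → ∀ {u v w} → Lift R u v → Lift S v w → Lift T u w
  Lift-trans f (σ , h) (τ , k) = ↔-trans σ τ , λ i → f (h i) (k (to σ i))

module _ {C : Set₁} {R : C → C → Set₁} (rf : ∀ a → R a a) where
  Lift-reindex : ∀ {u v : MSet C} (σ : Idx u ↔ Idx v) → (∀ i → lab v (to σ i) ≡ lab u i) → Lift R u v
  Lift-reindex {u} σ e = σ , λ i → subst (R (lab u i)) (sym (e i)) (rf (lab u i))

  Lift-refl : ∀ {u} → Lift R u u
  Lift-refl = Lift-reindex ↔-refl (λ _ → refl)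

  ⊕-assoc : ∀ {u v w} → Lift R ((u ⊕ v) ⊕ w) (u ⊕ (v ⊕ w))
  ⊕-assoc = Lift-reindex (⊎-assoc 0ℓ _ _ _) λ { (inj₁ (inj₁ x)) → refl ; (inj₁ (inj₂ x)) → refl ; (inj₂ x) → refl }

  ⊕-interchange : ∀ {a b c d} → Lift R ((a ⊕ b) ⊕ (c ⊕ d)) ((a ⊕ c) ⊕ (b ⊕ d))
  ⊕-interchange = Lift-reindex ⊎-interchange
    λ { (inj₁ (inj₁ x)) → refl ; (inj₁ (inj₂ x)) → refl ; (inj₂ (inj₁ x)) → refl ; (inj₂ (inj₂ x)) → refl }

  ⊕-shuffle : ∀ {a b c d} → Lift R ((a ⊕ c) ⊕ (b ⊕ d)) (a ⊕ (b ⊕ (c ⊕ d)))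
  ⊕-shuffle = Lift-reindex (↔-trans ⊎-interchange (⊎-assoc 0ℓ _ _ _))
    λ { (inj₁ (inj₁ x)) → refl ; (inj₁ (inj₂ x)) → refl ; (inj₂ (inj₁ x)) → refl ; (inj₂ (inj₂ x)) → refl }

  ΣM-⊕ : ∀ {I c} {F G : I → MSet C} → Lift R (ΣM I c (λ i → F i ⊕ G i)) (ΣM I c F ⊕ ΣM I c G)
  ΣM-⊕ = Lift-reindex Σ-distribˡ-⊎ λ { (i , inj₁ x) → refl ; (i , inj₂ y) → refl }

  ΣM-⊎ : ∀ {I J c d} {F : I ⊎ J → MSet C} →
         Lift R (ΣM (I ⊎ J) (countable-⊎ c d) F) (ΣM I c (F ∘ inj₁) ⊕ ΣM J d (F ∘ inj₂))
  ΣM-⊎ = Lift-reindex Σ-distribʳ-⊎ λ { (inj₁ i , x) → refl ; (inj₂ j , x) → refl }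

  ΣM-assoc : ∀ {I c} {J : I → Set} {d : ∀ i → Countable (J i)} {F : Σ I J → MSet C} →
             Lift R (ΣM (Σ I J) (countable-Σ c d) F) (ΣM I c (λ i → ΣM (J i) (d i) (λ j → F (i , j))))
  ΣM-assoc = Lift-reindex Σ-assoc-alt λ _ → refl

  ⨁-⊕ : ∀ {U V : MSet (MSet C)} → Lift R (⨁ (U ⊕ V)) (⨁ U ⊕ ⨁ V)
  ⨁-⊕ = ΣM-⊎

  ⨁-ΣM : ∀ {I c} {F : I → MSet (MSet C)} → Lift R (⨁ (ΣM I c F)) (ΣM I c (λ i → ⨁ (F i)))
  ⨁-ΣM = Lift-reindex Σ-assoc-alt λ _ → refl

open IsEquivalence using () renaming (refl to ≈-refl; sym to ≈-sym; trans to ≈-trans)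

IsSetoid : Obj → Set₁
IsSetoid O = IsEquivalence (_≈_ O)

≈-refl-at : ∀ {O} → IsSetoid O → ∀ a → _≈_ O a a
≈-refl-at E a = ≈-refl E

isSetoid-small : (X : SmallObj) → IsSetoid ⌊ X ⌋
isSetoid-small X = Setoid.isEquivalence (SmallObj.setoid X)

isSetoid-& : ∀ {A B} → IsSetoid A → IsSetoid B → IsSetoid (A & B)
isSetoid-& {A} {B} EA EB = record { refl = λ {a} → refl′ a ; sym = λ {a} {b} → sym′ a b ; trans = λ {a} {b} {c} → trans′ a b c }
  where
  module EA = IsEquivalence EA
  module EB = IsEquivalence EB
  refl′ : ∀ a → sumEq A B a a
  refl′ (inj₁ x) = EA.refl
  refl′ (inj₂ x) = EB.refl
  sym′ : ∀ a b → sumEq A B a b → sumEq A B b a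
  sym′ (inj₁ x) (inj₁ y) p = EA.sym p
  sym′ (inj₂ x) (inj₂ y) p = EB.sym p
  sym′ (inj₁ x) (inj₂ y) ()
  sym′ (inj₂ x) (inj₁ y) ()
  trans′ : ∀ a b c → sumEq A B a b → sumEq A B b c → sumEq A B a c
  trans′ (inj₁ x) (inj₁ y) (inj₁ z) p q = EA.trans p q
  trans′ (inj₂ x) (inj₂ y) (inj₂ z) p q = EB.trans p q
  trans′ (inj₁ x) (inj₂ y) _ ()
  trans′ (inj₂ x) (inj₁ y) _ ()
  trans′ (inj₁ x) (inj₁ y) (inj₂ z) _ ()
  trans′ (inj₂ x) (inj₂ y) (inj₁ z) _ ()

isSetoid-! : ∀ {A} → IsSetoid A → IsSetoid (! A)
isSetoid-! {A} E = record { refl = λ {u} → refl′ u ; sym = λ {u} {v} → sym′ u v ; trans = λ {u} {v} {w} → trans′ u v w }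
  where
  refl′ : ∀ u → MsEq A u u
  refl′ u = Lift⇒Σ {R = _≈_ A} {u} {u} (Lift-refl (≈-refl-at E))
  sym′ : ∀ u v → MsEq A u v → MsEq A v u
  sym′ u v p = Lift⇒Σ {R = _≈_ A} {v} {u} (Lift-sym (≈-sym E) (Σ⇒Lift {R = _≈_ A} {u} {v} p))
  trans′ : ∀ u v w → MsEq A u v → MsEq A v w → MsEq A u w
  trans′ u v w p q = Lift⇒Σ {R = _≈_ A} {u} {w} (Lift-trans (≈-trans E) (Σ⇒Lift {R = _≈_ A} {u} {v} p) (Σ⇒Lift {R = _≈_ A} {v} {w} q))

isSetoid-⊗ : ∀ {A B} → IsSetoid A → IsSetoid B → IsSetoid (A ⊗ B)
isSetoid-⊗ EA EB = record { refl = EA.refl , EB.refl ; sym = λ p → EA.sym (proj₁ p) , EB.sym (proj₂ p)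
                    ; trans = λ p q → EA.trans (proj₁ p) (proj₁ q) , EB.trans (proj₂ p) (proj₂ q) }
  where
  module EA = IsEquivalence EA
  module EB = IsEquivalence EB

isSetoid-!⊗! : ∀ {A B} → IsSetoid A → IsSetoid B → IsSetoid (! A ⊗ ! B)
isSetoid-!⊗! EA EB = isSetoid-⊗ (isSetoid-! EA) (isSetoid-! EB)

retarget : ∀ {S T : Obj} {f : Hom S T} → IsSetoid S → IsMor f →
           ∀ {p b b'} → _≈_ T b b' → R f p b → R f p b'
retarget ES fm {p} e r = fm (≈-refl ES {p}) e r

Perm : (O : Obj) → MSet (Car O) → MSet (Car O) → Set₁
Perm O = Lift (_≈_ O)

module PermProps {O : Obj} (E : IsSetoid O) where
  perm-refl : ∀ {u} → Perm O u u
  perm-refl = Lift-refl (≈-refl-at E)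
  perm-sym : ∀ {u v} → Perm O u v → Perm O v u
  perm-sym = Lift-sym (≈-sym E)
  infixr 5 _■_
  _■_ : ∀ {u v w} → Perm O u v → Perm O v w → Perm O u w
  _■_ = Lift-trans (≈-trans E)

inl : ∀ {A B : Obj} → MSet (Car A) → MSet (Car (A & B))
inl = mapM inj₁
inr : ∀ {A B : Obj} → MSet (Car B) → MSet (Car (A & B))
inr = mapM inj₂

module _ {X : Obj} (E : IsSetoid X) where
  private
    tag : ∀ {I J : Set} → I ⊎ J → Car X → Car X ⊎ Car X
    tag (inj₁ _) a = inj₁ a
    tag (inj₂ _) a = inj₂ a
    h1 : ∀ {u1 u2 : MSet (Car X)} a z → _≈_ X a ([ lab u1 , lab u2 ]′ z) →
         sumEq X X (tag z a) ([ inj₁ ∘ lab u1 , inj₂ ∘ lab u2 ]′ z)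
    h1 a (inj₁ x) p = p
    h1 a (inj₂ y) p = p
    h2 : ∀ {I J : Set} a (z : I ⊎ J) → sumEq X X (tag z a) (inj₁ a) ⊎ sumEq X X (tag z a) (inj₂ a)
    h2 a (inj₁ _) = inj₁ (≈-refl E)
    h2 a (inj₂ _) = inj₂ (≈-refl E)
    h3 : ∀ {u1 u2 : MSet (Car X)} a x z → sumEq X X x (inj₁ a) ⊎ sumEq X X x (inj₂ a) →
         sumEq X X x ([ inj₁ ∘ lab u1 , inj₂ ∘ lab u2 ]′ z) → _≈_ X a ([ lab u1 , lab u2 ]′ z)
    h3 a (inj₁ x) (inj₁ k) (inj₁ p) q = ≈-trans E (≈-sym E p) q
    h3 a (inj₂ x) (inj₂ k) (inj₂ p) q = ≈-trans E (≈-sym E p) q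
    h3 a (inj₁ x) (inj₂ k) _ ()
    h3 a (inj₂ x) (inj₁ k) _ ()
    h3 a (inj₁ x) (inj₁ k) (inj₂ ()) q
    h3 a (inj₂ x) (inj₂ k) (inj₁ ()) q

  c-intro : ∀ {w u1 u2} → Perm X w (u1 ⊕ u2) → R (c X) w (u1 , u2)
  c-intro {w} {u1} {u2} (σ , h) =
    mset (Idx w) (cnt w) (λ i → tag (to σ i) (lab w i)) ,
    (↔-refl , λ i → h2 (lab w i) (to σ i)) ,
    (σ , λ i → h1 {u1} {u2} (lab w i) (to σ i) (h i))

  c-elim : ∀ {w u1 u2} → R (c X) w (u1 , u2) → Perm X w (u1 ⊕ u2)
  c-elim {w} {u1} {u2} (w' , (τ , d) , (σ , e)) =
    ↔-trans τ σ , λ i → h3 {u1} {u2} (lab w i) (lab w' (to τ i)) (to σ (to τ i)) (d i) (e (to τ i))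

module _ {X A : Obj} (EX : IsSetoid X) (EA : IsSetoid A) where
  private
    E = isSetoid-& EX EA
    module E = IsEquivalence E
  -- sumEq never relates an inj₁ to an inj₂, so the bijection respects the two summands.
  cancel-inl⊕inr : ∀ {a b a' b'} → Perm (X & A) (inl {X} {A} a ⊕ inr {X} {A} b) (inl {X} {A} a' ⊕ inr {X} {A} b') →
           Perm X a a' × Perm A b b'
  cancel-inl⊕inr {a} {b} {a'} {b'} P = (mk↔ₛ′ t1 f1 tf1 ft1 , l1) , (mk↔ₛ′ t2 f2 tf2 ft2 , l2)
    where
    σ = bij P
    Q = Lift-sym (λ {x} {y} → E.sym {x} {y}) P
    L : Car (X & A) → Car (X & A) → Set₁
    L = sumEq X A
    lp : ∀ i → L ([ (λ k → inj₁ (lab a k)) , (λ k → inj₂ (lab b k)) ]′ i)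
                 ([ (λ k → inj₁ (lab a' k)) , (λ k → inj₂ (lab b' k)) ]′ (to σ i))
    lp = lbl P
    lq : ∀ i → L ([ (λ k → inj₁ (lab a' k)) , (λ k → inj₂ (lab b' k)) ]′ i)
                 ([ (λ k → inj₁ (lab a k)) , (λ k → inj₂ (lab b k)) ]′ (from σ i))
    lq = lbl Q
    s1 : ∀ {I J : Set} {x} {g : I → Car X} {h : J → Car A} (z : I ⊎ J) →
         L (inj₁ x) ([ (λ k → inj₁ (g k)) , (λ k → inj₂ (h k)) ]′ z) → Σ I (λ k → z ≡ inj₁ k)
    s1 (inj₁ k) p = k , refl
    s1 (inj₂ k) ()
    s2 : ∀ {I J : Set} {x} {g : I → Car X} {h : J → Car A} (z : I ⊎ J) →
         L (inj₂ x) ([ (λ k → inj₁ (g k)) , (λ k → inj₂ (h k)) ]′ z) → Σ J (λ k → z ≡ inj₂ k)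
    s2 (inj₂ k) p = k , refl
    s2 (inj₁ k) ()
    t1 : Idx a → Idx a'
    t1 k = proj₁ (s1 (to σ (inj₁ k)) (lp (inj₁ k)))
    e1 : ∀ k → to σ (inj₁ k) ≡ inj₁ (t1 k)
    e1 k = proj₂ (s1 (to σ (inj₁ k)) (lp (inj₁ k)))
    f1 : Idx a' → Idx a
    f1 k = proj₁ (s1 (from σ (inj₁ k)) (lq (inj₁ k)))
    g1 : ∀ k → from σ (inj₁ k) ≡ inj₁ (f1 k)
    g1 k = proj₂ (s1 (from σ (inj₁ k)) (lq (inj₁ k)))
    t2 : Idx b → Idx b'
    t2 k = proj₁ (s2 (to σ (inj₂ k)) (lp (inj₂ k)))
    e2 : ∀ k → to σ (inj₂ k) ≡ inj₂ (t2 k)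
    e2 k = proj₂ (s2 (to σ (inj₂ k)) (lp (inj₂ k)))
    f2 : Idx b' → Idx b
    f2 k = proj₁ (s2 (from σ (inj₂ k)) (lq (inj₂ k)))
    g2 : ∀ k → from σ (inj₂ k) ≡ inj₂ (f2 k)
    g2 k = proj₂ (s2 (from σ (inj₂ k)) (lq (inj₂ k)))
    tf1 : ∀ k → t1 (f1 k) ≡ k
    tf1 k = inj₁-injective (trans (sym (e1 (f1 k))) (trans (cong (to σ) (sym (g1 k))) (strictlyInverseˡ σ (inj₁ k))))
    ft1 : ∀ k → f1 (t1 k) ≡ k
    ft1 k = inj₁-injective (trans (sym (g1 (t1 k))) (trans (cong (from σ) (sym (e1 k))) (strictlyInverseʳ σ (inj₁ k))))
    tf2 : ∀ k → t2 (f2 k) ≡ k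
    tf2 k = inj₂-injective (trans (sym (e2 (f2 k))) (trans (cong (to σ) (sym (g2 k))) (strictlyInverseˡ σ (inj₂ k))))
    ft2 : ∀ k → f2 (t2 k) ≡ k
    ft2 k = inj₂-injective (trans (sym (g2 (t2 k))) (trans (cong (from σ) (sym (e2 k))) (strictlyInverseʳ σ (inj₂ k))))
    l1 : ∀ k → _≈_ X (lab a k) (lab a' (t1 k))
    l1 k = subst (λ z → L (inj₁ (lab a k)) ([ (λ k → inj₁ (lab a' k)) , (λ k → inj₂ (lab b' k)) ]′ z)) (e1 k) (lp (inj₁ k))
    l2 : ∀ k → _≈_ A (lab b k) (lab b' (t2 k))
    l2 k = subst (λ z → L (inj₂ (lab b k)) ([ (λ k → inj₁ (lab a' k)) , (λ k → inj₂ (lab b' k)) ]′ z)) (e2 k) (lp (inj₂ k))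

module _ {C : Set₁} {Rr : C → C → Set₁} (rf : ∀ a → Rr a a) where
  ΣM-reidx : ∀ {I J c d} (σ : I ↔ J) (F : I → MSet C) →
             Lift Rr (ΣM I c F) (ΣM J d (λ j → F (from σ j)))
  ΣM-reidx {c = c} {d = d} σ F = Lift-ΣM {c = c} {d = d} {F = F} {G = λ j → F (from σ j)} σ
    (λ i → subst (λ z → Lift Rr (F i) (F z)) (sym (strictlyInverseʳ σ i)) (Lift-refl rf))

  mapM-ΣM : ∀ {D : Set₁} {g : D → C} {I c} {F : I → MSet D} →
            Lift Rr (mapM g (ΣM I c F)) (ΣM I c (λ i → mapM g (F i)))
  mapM-ΣM = Lift-reindex rf ↔-refl (λ _ → refl)

  mapM-⊕ : ∀ {D : Set₁} {g : D → C} {u v : MSet D} →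
           Lift Rr (mapM g (u ⊕ v)) (mapM g u ⊕ mapM g v)
  mapM-⊕ = Lift-reindex rf ↔-refl (λ { (inj₁ x) → refl ; (inj₂ y) → refl })

unroll : (X B A : Obj) → Hom (! X ⊗ ! B) A → Hom (! X) B → Hom (! X) A
unroll X B A f Y = f ∘ₕ (idₕ (! X) ⊗ₕ (!ₕ Y ∘ₕ dig X)) ∘ₕ c X

module _ {X B A : Obj} (EX : IsSetoid X) {f : Hom (! X ⊗ ! B) A} {Y : Hom (! X) B} where
  open PermProps EX
  unroll-intro : ∀ {w u W V a} → Perm X w (u ⊕ ⨁ W) → Lift (R Y) W V → R f (u , V) a → R (unroll X B A f Y) w a
  unroll-intro {w} {u} {W} {V} p q r' =
    (u , V) , ((u , ⨁ W) , c-intro EX p ,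
    (Lift⇒Σ {R = _≈_ X} {u} {u} perm-refl , (W , Lift⇒Σ {R = _≈_ X} {⨁ W} {⨁ W} perm-refl , Lift⇒Σ {R = R Y} {W} {V} q))) , r'

  record UnrollView (w : MSet (Car X)) (a : Car A) : Set₂ where
    field
      u : MSet (Car X)
      W : MSet (MSet (Car X))
      V : MSet (Car B)
      ew : Perm X w (u ⊕ ⨁ W)
      lY : Lift (R Y) W V
      rf : R f (u , V) a

  unroll-elim : ∀ {w a} → R (unroll X B A f Y) w a → UnrollView w a
  unroll-elim {w} {a} ((u , V) , ((u1 , w2) , cp , (e1 , (W , dg , lY))) , r') = record
    { u = u ; W = W ; V = V
    ; ew = c-elim EX cp ■ Lift-⊕ (Σ⇒Lift {R = _≈_ X} {u1} {u} e1) (Σ⇒Lift {R = _≈_ X} {w2} {⨁ W} dg)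
    ; lY = Σ⇒Lift {R = R Y} {W} {V} lY ; rf = r' }

precomp : (X Z A : Obj) → Hom (! X) Z → Hom (! Z ⊗ ! A) A → Hom (! X ⊗ ! A) A
precomp X Z A g f = f ∘ₕ ((!ₕ g ∘ₕ dig X) ⊗ₕ idₕ (! A))

module _ {X Z A : Obj} (EX : IsSetoid X) (EZ : IsSetoid Z) (EA : IsSetoid A) {g : Hom (! X) Z} {f : Hom (! Z ⊗ ! A) A} where
  precomp-intro : ∀ {u v b W z} → Perm X u (⨁ W) → Lift (R g) W z → R f (z , v) b → R (precomp X Z A g f) (u , v) b
  precomp-intro {u} {v} {b} {W} {z} p q r' =
    (z , v) , ((W , Lift⇒Σ {R = _≈_ X} {u} {⨁ W} p , Lift⇒Σ {R = R g} {W} {z} q) , ≈-refl (isSetoid-! EA) {v}) , r'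

  record PrecompView (u : MSet (Car X)) (v : MSet (Car A)) (b : Car A) : Set₂ where
    field
      W : MSet (MSet (Car X))
      z : MSet (Car Z)
      eu : Perm X u (⨁ W)
      lg : Lift (R g) W z
      rf : R f (z , v) b

  precomp-elim : IsMor f → ∀ {u v b} → R (precomp X Z A g f) (u , v) b → PrecompView u v b
  precomp-elim fm {u} {v} {b} ((z , v') , ((W , d , lg) , ev) , r') = record
    { W = W ; z = z ; eu = Σ⇒Lift {R = _≈_ X} {u} {⨁ W} d ; lg = Σ⇒Lift {R = R g} {W} {z} lg
    ; rf = fm (≈-refl (isSetoid-! EZ) {z} , ≈-sym (isSetoid-! EA) {v} {v'} ev) (≈-refl EA {b}) r' }

module _ {X A B : Obj} (EX : IsSetoid X) (EA : IsSetoid A) (EB : IsSetoid B)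
         {f : Hom (! X ⊗ ! B) A} {g : Hom (! X ⊗ ! A) B} where
  private
    EXA = isSetoid-& EX EA
  record StarView (u : MSet (Car X)) (v : MSet (Car A)) (a : Car A) : Set₂ where
    field
      u0 : MSet (Car X)
      I  : Set
      cI : Countable I
      x  : I → MSet (Car X)
      y  : I → MSet (Car A)
      b  : I → Car B
      eu : Perm X u (u0 ⊕ ΣM I cI x)
      ev : Perm A v (ΣM I cI y)
      rg : ∀ i → R g (x i , y i) (b i)
      rf : R f (u0 , mset I cI b) a

  private
    module X' = PermProps EX
    module A' = PermProps EA
    module XA = PermProps EXA

  ΣM-inl⊕inr : ∀ {I c} (x : I → MSet (Car X)) (y : I → MSet (Car A)) →
    Perm (X & A) (ΣM I c (λ i → inl {X} {A} (x i) ⊕ inr {X} {A} (y i))) (inl {X} {A} (ΣM I c x) ⊕ inr {X} {A} (ΣM I c y))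
  ΣM-inl⊕inr {I} {c} x y =
    ΣM-⊕ (≈-refl-at EXA)
    XA.■ Lift-⊕ (XA.perm-sym (mapM-ΣM (≈-refl-at EXA) {g = inj₁} {F = x}))
                (XA.perm-sym (mapM-ΣM (≈-refl-at EXA) {g = inj₂} {F = y}))

  star-intro : ∀ {u v a} → StarView u v a → R (star X A B f g) (u , v) a
  star-intro {u} {v} {a} d =
    (u0 , mset I cI b) ,
    ((u0 , W) ,
     ((u0 , w) ,
      ((u0 , (ΣM I cI x , ΣM I cI y)) ,
       (((u0 , ΣM I cI x) , ΣM I cI y) ,
        (c-intro EX eu , Lift⇒Σ {R = _≈_ A} {v} {ΣM I cI y} ev) ,
        (≈-refl (isSetoid-! EX) {u0} , (≈-refl (isSetoid-! EX) {ΣM I cI x} , ≈-refl (isSetoid-! EA) {ΣM I cI y}))) ,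
       (≈-refl (isSetoid-! EX) {u0} , Lift⇒Σ {R = _≈_ (X & A)} {w} {inl {X} {A} (ΣM I cI x) ⊕ inr {X} {A} (ΣM I cI y)} XA.perm-refl)) ,
      (≈-refl (isSetoid-! EX) {u0} , Lift⇒Σ {R = _≈_ (X & A)} {w} {⨁ W} (XA.perm-sym (ΣM-inl⊕inr x y)))) ,
     (≈-refl (isSetoid-! EX) {u0} ,
      (↔-refl , λ i → (x i , y i) , Lift⇒Σ {R = _≈_ (X & A)} {lab W i} {inl {X} {A} (x i) ⊕ inr {X} {A} (y i)} XA.perm-refl , rg i))) ,
    rf
    where
    open StarView d
    w = inl {X} {A} (ΣM I cI x) ⊕ inr {X} {A} (ΣM I cI y)
    W : MSet (MSet (Car (X & A)))
    W = mset I cI (λ i → inl {X} {A} (x i) ⊕ inr {X} {A} (y i))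

  star-elim : ∀ {u v a} → R (star X A B f g) (u , v) a → StarView u v a
  star-elim {u} {v} {a}
    ((u04 , Bs) , ((u03 , W) , ((u02 , w) , ((u01 , (u1' , v1')) ,
      (((u0 , u1) , v1) , (cp , ev1) , (e0 , (e1 , ev2))) , (e0' , mw)) , (e0'' , dw)) , (e0''' , lB)) , rf') =
    record { u0 = u04 ; I = Idx Bs ; cI = cnt Bs ; x = x ; y = y ; b = lab Bs
           ; eu = c-elim EX cp X'.■ Lift-⊕ (tx u0 u01 e0 X'.■ tx u01 u02 e0' X'.■ tx u02 u03 e0'' X'.■ tx u03 u04 e0''') (tx u1 u1' e1 X'.■ proj₁ canc)
           ; ev = ta v v1 ev1 A'.■ ta v1 v1' ev2 A'.■ proj₂ canc
           ; rg = λ i → proj₂ (proj₂ (gm i)) ; rf = rf' }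
    where
    tx : ∀ p q → MsEq X p q → Perm X p q
    tx p q = Σ⇒Lift {R = _≈_ X} {p} {q}
    ta : ∀ p q → MsEq A p q → Perm A p q
    ta p q = Σ⇒Lift {R = _≈_ A} {p} {q}
    lB' : Lift (R (g ∘ₕ m⁻¹ X A)) W Bs
    lB' = Σ⇒Lift {R = R (g ∘ₕ m⁻¹ X A)} {W} {Bs} lB
    τ = bij lB'
    gm : ∀ i → R (g ∘ₕ m⁻¹ X A) (lab W (from τ i)) (lab Bs i)
    gm = Lift-from lB'
    x : Idx Bs → MSet (Car X)
    x i = proj₁ (proj₁ (gm i))
    y : Idx Bs → MSet (Car A)
    y i = proj₂ (proj₁ (gm i))
    mgm : ∀ i → Perm (X & A) (lab W (from τ i)) (inl {X} {A} (x i) ⊕ inr {X} {A} (y i))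
    mgm i = Σ⇒Lift {R = _≈_ (X & A)} {lab W (from τ i)} {inl {X} {A} (x i) ⊕ inr {X} {A} (y i)} (proj₁ (proj₂ (gm i)))
    P : Perm (X & A) (inl {X} {A} u1' ⊕ inr {X} {A} v1') (inl {X} {A} (ΣM (Idx Bs) (cnt Bs) x) ⊕ inr {X} {A} (ΣM (Idx Bs) (cnt Bs) y))
    P = XA.perm-sym (Σ⇒Lift {R = _≈_ (X & A)} {w} {inl {X} {A} u1' ⊕ inr {X} {A} v1'} mw)
        XA.■ Σ⇒Lift {R = _≈_ (X & A)} {w} {⨁ W} dw
        XA.■ ΣM-reidx (≈-refl-at EXA) {d = cnt Bs} τ (lab W)
        XA.■ Lift-ΣM {F = λ i → lab W (from τ i)} {G = λ i → inl {X} {A} (x i) ⊕ inr {X} {A} (y i)} ↔-refl mgm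
        XA.■ ΣM-inl⊕inr x y
    canc = cancel-inl⊕inr EX EA P

uncurryArg : (X A : Obj) → Hom ((! X ⊗ ! A) ⊗ ! A) A → Hom (! (X & A) ⊗ ! A) A
uncurryArg X A f = f ∘ₕ (m⁻¹ X A ⊗ₕ idₕ (! A))

diagArg : (X A : Obj) → Hom ((! X ⊗ ! A) ⊗ ! A) A → Hom (! X ⊗ ! A) A
diagArg X A f = f ∘ₕ α⁻¹ (! X) (! A) (! A) ∘ₕ (idₕ (! X) ⊗ₕ (m⁻¹ A A ∘ₕ !ₕ (Δ A)))

module _ {X A : Obj} (EX : IsSetoid X) (EA : IsSetoid A) {f : Hom ((! X ⊗ ! A) ⊗ ! A) A} where
  private
    EXA = isSetoid-& EX EA
    E!X = isSetoid-! EX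
    E!A = isSetoid-! EA
    module A' = PermProps EA
  uncurryArg-intro : ∀ {w v b ux ua} → R f ((ux , ua) , v) b → Perm (X & A) w (inl {X} {A} ux ⊕ inr {X} {A} ua) →
             R (uncurryArg X A f) (w , v) b
  uncurryArg-intro {w} {v} {b} {ux} {ua} r' p =
    ((ux , ua) , v) , (Lift⇒Σ {R = _≈_ (X & A)} {w} {inl {X} {A} ux ⊕ inr {X} {A} ua} p , ≈-refl E!A {v}) , r'

  record UncurryView (w : MSet (Car (X & A))) (v : MSet (Car A)) (b : Car A) : Set₂ where
    field
      ux : MSet (Car X)
      ua : MSet (Car A)
      ew : Perm (X & A) w (inl {X} {A} ux ⊕ inr {X} {A} ua)
      rf : R f ((ux , ua) , v) b

  uncurryArg-elim : IsMor f → ∀ {w v b} → R (uncurryArg X A f) (w , v) b → UncurryView w v b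
  uncurryArg-elim fm {w} {v} {b} (((ux , ua) , v') , (p , ev) , r') = record
    { ux = ux ; ua = ua ; ew = Σ⇒Lift {R = _≈_ (X & A)} {w} {inl {X} {A} ux ⊕ inr {X} {A} ua} p
    ; rf = fm ((≈-refl E!X {ux} , ≈-refl E!A {ua}) , ≈-sym E!A {v} {v'} ev) (≈-refl EA {b}) r' }

  diagArg-intro : ∀ {u v b v1 v2} → R f ((u , v1) , v2) b → Perm A v (v1 ⊕ v2) → R (diagArg X A f) (u , v) b
  diagArg-intro {u} {v} {b} {v1} {v2} r' p =
    ((u , v1) , v2) , ((u , (v1 , v2)) , (≈-refl E!X {u} , c-intro EA p) , (≈-refl E!X {u} , (≈-refl E!A {v1} , ≈-refl E!A {v2}))) , r'

  record DiagView (u : MSet (Car X)) (v : MSet (Car A)) (b : Car A) : Set₂ where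
    field
      v1 : MSet (Car A)
      v2 : MSet (Car A)
      ev : Perm A v (v1 ⊕ v2)
      rf : R f ((u , v1) , v2) b

  diagArg-elim : IsMor f → ∀ {u v b} → R (diagArg X A f) (u , v) b → DiagView u v b
  diagArg-elim fm {u} {v} {b} (((q11 , q12) , q2) , ((u' , (w1 , w2)) , (eu , cp) , (e11 , (e12 , e2))) , r') = record
    { v1 = q12 ; v2 = q2
    ; ev = c-elim EA cp A'.■ Lift-⊕ (A'.perm-sym (Σ⇒Lift {R = _≈_ A} {q12} {w1} e12)) (A'.perm-sym (Σ⇒Lift {R = _≈_ A} {q2} {w2} e2))
    ; rf = fm ((≈-trans E!X {q11} {u'} {u} e11 (≈-sym E!X {u} {u'} eu) , ≈-refl E!A {q12}) , ≈-refl E!A {q2}) (≈-refl EA {b}) r' }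

-- The inductive fixpoint

module Trees (X A : Obj) (f : Hom (! X ⊗ ! A) A) where
  open RunTrees X A f public

  leaves : ∀ {b} → Tree b → MSet (Car X)
  leaves (node u v p ts) = u ⊕ ΣM (Idx v) (cnt v) (λ i → leaves (ts i))

  leaf⇒idx : ∀ {b} {t : Tree b} → Leaf t → Idx (leaves t)
  leaf⇒idx (here k) = inj₁ k
  leaf⇒idx (there i l) = inj₂ (i , leaf⇒idx l)

  idx⇒leaf : ∀ {b} (t : Tree b) → Idx (leaves t) → Leaf t
  idx⇒leaf (node u v p ts) (inj₁ k) = here k
  idx⇒leaf (node u v p ts) (inj₂ (i , x)) = there i (idx⇒leaf (ts i) x)

  idx⇒leaf⇒idx : ∀ {b} {t : Tree b} (l : Leaf t) → idx⇒leaf t (leaf⇒idx l) ≡ l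
  idx⇒leaf⇒idx (here k) = refl
  idx⇒leaf⇒idx (there i l) = cong (there i) (idx⇒leaf⇒idx l)

  leaf⇒idx⇒leaf : ∀ {b} (t : Tree b) (x : Idx (leaves t)) → leaf⇒idx (idx⇒leaf t x) ≡ x
  leaf⇒idx⇒leaf (node u v p ts) (inj₁ k) = refl
  leaf⇒idx⇒leaf (node u v p ts) (inj₂ (i , x)) = cong (λ z → inj₂ (i , z)) (leaf⇒idx⇒leaf (ts i) x)

  Leaf↔leaves : ∀ {b} (t : Tree b) → Leaf t ↔ Idx (leaves t)
  Leaf↔leaves t = mk↔ₛ′ leaf⇒idx (idx⇒leaf t) (leaf⇒idx⇒leaf t) idx⇒leaf⇒idx

  leaf-label : ∀ {b} {t : Tree b} (l : Leaf t) → lab (leaves t) (leaf⇒idx l) ≡ leafLab l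
  leaf-label (here k) = refl
  leaf-label (there i l) = leaf-label l

  retag : (∀ p b b' → _≈_ A b b' → R f p b → R f p b') → ∀ {b b'} → _≈_ A b b' →
            ∀ {w : MSet (Car X)} → Σ (Tree b) (λ t → Perm X w (leaves t)) → Σ (Tree b') (λ t → Perm X w (leaves t))
  retag rt {b} {b'} e (node u v p ts , m) = node u v (rt (u , v) b b' e p) ts , m

module _ {X A : Obj} (EX : IsSetoid X) {f : Hom (! X ⊗ ! A) A} where
  open Trees X A f
  open PermProps EX

  Yind⇒tree : ∀ {w a} → R (Yind X A f) w a → Σ (Tree a) (λ t → Perm X w (leaves t))
  Yind⇒tree {w} (t , σ , h) = t , (↔-trans σ (Leaf↔leaves t) , λ k → subst (_≈_ X (lab w k)) (sym (leaf-label (to σ k))) (h k))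

  tree⇒Yind : ∀ {w a} → Σ (Tree a) (λ t → Perm X w (leaves t)) → R (Yind X A f) w a
  tree⇒Yind {w} (t , (τ , h)) = t , ↔-trans τ (↔-sym (Leaf↔leaves t)) ,
    λ k → subst (_≈_ X (lab w k)) (trans (cong (lab (leaves t)) (sym (leaf⇒idx⇒leaf t (to τ k)))) (leaf-label (idx⇒leaf t (to τ k)))) (h k)


ind-mor : ∀ {X A : Obj} (EX : IsSetoid X) (EA : IsSetoid A) (f : Hom (! X ⊗ ! A) A) → IsMor f → IsMor (Yind X A f)
ind-mor {X} {A} EX EA f fm {w} {w'} {a} {a'} ew ea y =
  tree⇒Yind EX {f = f} (Trees.retag X A f rt ea (t , perm-sym (Σ⇒Lift {R = _≈_ X} {w} {w'} ew) ■ p))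
  where
  rt : ∀ p b b' → _≈_ A b b' → R f p b → R f p b'
  rt p b b' = retarget {f = f} (isSetoid-!⊗! EX EA) fm
  open PermProps EX
  tp = Yind⇒tree EX {f = f} y
  t = proj₁ tp
  p = proj₂ tp

module _ {X A : Obj} (EX : IsSetoid X) {f f' : Hom (! X ⊗ ! A) A} (ff : ∀ p b → R f p b → R f' p b) where
  open PermProps EX
  private
    module F = Trees X A f
    module F' = Trees X A f'
  tree-map : ∀ {b} → F.Tree b → F'.Tree b
  tree-map (F.node u v p ts) = F'.node u v (ff _ _ p) (λ i → tree-map (ts i))
  tree-map-leaves : ∀ {b} (t : F.Tree b) → Perm X (F.leaves t) (F'.leaves (tree-map t))
  tree-map-leaves (F.node u v p ts) = Lift-⊕ perm-refl (Lift-ΣM′ (λ i → tree-map-leaves (ts i)))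
  Yind-mono : ∀ {w a} → R (Yind X A f) w a → R (Yind X A f') w a
  Yind-mono {w} {a} y = tree⇒Yind EX {f = f'} {w} {a} (tree-map (proj₁ ty) , proj₂ ty ■ tree-map-leaves (proj₁ ty))
    where ty = Yind⇒tree EX {f = f} {w} {a} y

ind-eq : ∀ {X A : Obj} (EX : IsSetoid X) (f f' : Hom (! X ⊗ ! A) A) → f ≐ f' → Yind X A f ≐ Yind X A f'
ind-eq EX f f' e w a = Yind-mono EX {f = f} {f' = f'} (λ p b → proj₁ (e p b)) {w} {a} , Yind-mono EX {f = f'} {f' = f} (λ p b → proj₂ (e p b)) {w} {a}

ind-law2 : ∀ {X A : Obj} (EX : IsSetoid X) (EA : IsSetoid A) (f : Hom (! X ⊗ ! A) A) →
  Yind X A f ≐ (f ∘ₕ (idₕ (! X) ⊗ₕ (!ₕ (Yind X A f) ∘ₕ dig X)) ∘ₕ c X)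
ind-law2 {X} {A} EX EA f w a = to' , from'
  where
  open Trees X A f
  open PermProps EX
  to' : R (Yind X A f) w a → R (unroll X A A f (Yind X A f)) w a
  to' y with Yind⇒tree EX {f = f} {w} {a} y
  ... | node u v p ts , e =
    unroll-intro EX {f = f} {Y = Yind X A f} {W = mset (Idx v) (cnt v) (λ i → leaves (ts i))} {V = v} e
      (↔-refl , λ i → tree⇒Yind EX {f = f} (ts i , perm-refl)) p
  from' : R (unroll X A A f (Yind X A f)) w a → R (Yind X A f) w a
  from' φ = tree⇒Yind EX {f = f} {w} {a} (node u V rf (λ i → proj₁ (ch i)) ,
      ew ■ Lift-⊕ perm-refl (ΣM-reidx (≈-refl-at EX) {c = cnt W} {d = cnt V} (bij lY) (lab W) ■ Lift-ΣM′ (λ i → proj₂ (ch i))))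
    where
    open UnrollView (unroll-elim EX {f = f} {Y = Yind X A f} φ)
    ch : ∀ i → Σ (Tree (lab V i)) (λ t → Perm X (lab W (from (bij lY) i)) (leaves t))
    ch i = Yind⇒tree EX {f = f} (Lift-from lY i)

module _ {X Z A : Obj} (EX : IsSetoid X) (EZ : IsSetoid Z) (EA : IsSetoid A)
         (g : Hom (! X) Z) (f : Hom (! Z ⊗ ! A) A) (gm : IsMor g) (fm : IsMor f) where
  private
    fg = precomp X Z A g f
    module TF = Trees Z A f
    module TG = Trees X A fg
    module MX = PermProps EX
    module MZ = PermProps EZ

  record Unprecomp {b} (t' : TG.Tree b) : Set₂ where
    field
      t : TF.Tree b
      W : MSet (MSet (Car X))
      e : Perm X (TG.leaves t') (⨁ W)
      l : Lift (R g) W (TF.leaves t)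
  open Unprecomp

  unprecomp : ∀ {b} (t' : TG.Tree b) → Unprecomp t'
  unprecomp (TG.node u v p ts) = record
    { t = TF.node (PrecompView.z d) v (PrecompView.rf d) (λ i → t (rec i))
    ; W = PrecompView.W d ⊕ ΣM (Idx v) (cnt v) (λ i → W (rec i))
    ; e = Lift-⊕ (PrecompView.eu d) (Lift-ΣM′ (λ i → e (rec i))) MX.■
          MX.perm-sym (⨁-⊕ (≈-refl-at EX) {U = PrecompView.W d} MX.■ Lift-⊕ MX.perm-refl (⨁-ΣM (≈-refl-at EX) {F = λ i → W (rec i)}))
    ; l = Lift-⊕ (PrecompView.lg d) (Lift-ΣM′ (λ i → l (rec i))) }
    where
    d = precomp-elim EX EZ EA {g = g} {f = f} fm p
    rec = λ i → unprecomp (ts i)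

  precompTree : ∀ {b} (t : TF.Tree b) (F : Idx (TF.leaves t) → MSet (Car X)) →
          (∀ l → R g (F l) (lab (TF.leaves t) l)) →
          Σ (TG.Tree b) (λ t' → Perm X (TG.leaves t') (ΣM (Idx (TF.leaves t)) (cnt (TF.leaves t)) F))
  precompTree (TF.node u v p ts) F hg =
    TG.node (ΣM (Idx u) (cnt u) (λ k → F (inj₁ k))) v
      (precomp-intro EX EZ EA {g = g} {f = f} {W = mset (Idx u) (cnt u) (λ k → F (inj₁ k))} {z = u} MX.perm-refl (↔-refl , λ k → hg (inj₁ k)) p)
      (λ i → proj₁ (rec i)) ,
    (Lift-⊕ MX.perm-refl (Lift-ΣM′ (λ i → proj₂ (rec i)))
     MX.■ MX.perm-sym (ΣM-⊎ (≈-refl-at EX) {F = F} MX.■ Lift-⊕ MX.perm-refl (ΣM-assoc (≈-refl-at EX) {F = λ p → F (inj₂ p)})))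
    where
    rec = λ i → precompTree (ts i) (λ l → F (inj₂ (i , l))) (λ l → hg (inj₂ (i , l)))

  ind-law1 : Yind X A fg ≐ (Yind Z A f ∘ₕ !ₕ g ∘ₕ dig X)
  ind-law1 w a = to' , from'
    where
    to' : R (Yind X A fg) w a → R (Yind Z A f ∘ₕ !ₕ g ∘ₕ dig X) w a
    to' y = TF.leaves (t cv) , (W cv , Lift⇒Σ {R = _≈_ X} {w} {⨁ (W cv)} (proj₂ ty MX.■ e cv) , Lift⇒Σ {R = R g} {W cv} {TF.leaves (t cv)} (l cv)) ,
            tree⇒Yind EZ {f = f} {TF.leaves (t cv)} {a} (t cv , MZ.perm-refl)
      where
      ty = Yind⇒tree EX {f = fg} {w} {a} y
      cv = unprecomp (proj₁ ty)
    from' : R (Yind Z A f ∘ₕ !ₕ g ∘ₕ dig X) w a → R (Yind X A fg) w a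
    from' (z , (W , d , lg) , y) =
      tree⇒Yind EX {f = fg} {w} {a} (proj₁ cv ,
        Σ⇒Lift {R = _≈_ X} {w} {⨁ W} d MX.■ ΣM-reidx (≈-refl-at EX) {c = cnt W} {d = cnt (TF.leaves tt0)} τ (lab W) MX.■ MX.perm-sym (proj₂ cv))
      where
      ty = Yind⇒tree EZ {f = f} {z} {a} y
      tt0 = proj₁ ty
      lg' : Lift (R g) W (TF.leaves tt0)
      lg' = Lift-trans (λ {x} {y} {z} r e → gm {x} {x} {y} {z} (≈-refl (isSetoid-! EX) {x}) e r) (Σ⇒Lift {R = R g} {W} {z} lg) (proj₂ ty)
      τ = bij lg'
      cv = precompTree tt0 (λ l → lab W (from τ l)) (Lift-from lg')

record Node (X B A : Obj) (f : Hom (! X ⊗ ! B) A) (K : Car B → Set₁) (a : Car A) : Set₁ where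
  field
    u0 : MSet (Car X)
    Bs : MSet (Car B)
    rf : R f (u0 , Bs) a
    ch : (j : Idx Bs) → K (lab Bs j)

nodeLeaves : ∀ {X B A : Obj} {f : Hom (! X ⊗ ! B) A} {K : Car B → Set₁} →
         (∀ {b} → K b → MSet (Car X)) → ∀ {a} → Node X B A f K a → MSet (Car X)
nodeLeaves {X} {B} {A} {f} {K} lvK n = Node.u0 n ⊕ ΣM (Idx (Node.Bs n)) (cnt (Node.Bs n)) (λ j → lvK {lab (Node.Bs n) j} (Node.ch n j))

retagNode : ∀ {X B A : Obj} {f : Hom (! X ⊗ ! B) A} {K : Car B → Set₁} →
         (∀ p a a' → _≈_ A a a' → R f p a → R f p a') → ∀ {a a'} → _≈_ A a a' → Node X B A f K a → Node X B A f K a'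
retagNode {X} {B} {A} {f} {K} rt {a} {a'} e n = record { u0 = Node.u0 n ; Bs = Node.Bs n ; rf = rt (Node.u0 n , Node.Bs n) a a' e (Node.rf n) ; ch = Node.ch n }

module StarAssemble {X A B : Obj} (EX : IsSetoid X) (EA : IsSetoid A) (EB : IsSetoid B)
           (f : Hom (! X ⊗ ! B) A) (g : Hom (! X ⊗ ! A) B) where
  private
    fg = star X A B f g
    module TFG = Trees X A fg
    module MX = PermProps EX

  GNode : Car B → Set₁
  GNode = Node X A B g TFG.Tree

  assemble : ∀ {a} → Node X B A f GNode a → TFG.Tree a
  assemble {a} n = TFG.node (u0 ⊕ ΣM I cI x) (ΣM I cI y) (star-intro EX EA EB {f = f} {g = g} sd) ch'
    where
    u0 = Node.u0 n
    Bs = Node.Bs n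
    ch : (j : Idx Bs) → GNode (lab Bs j)
    ch = Node.ch n
    I = Idx Bs
    cI = cnt Bs
    x : I → MSet (Car X)
    x j = Node.u0 (ch j)
    y : I → MSet (Car A)
    y j = Node.Bs (ch j)
    sd : StarView EX EA EB {f = f} {g = g} (u0 ⊕ ΣM I cI x) (ΣM I cI y) a
    sd = record
       { u0 = u0 ; I = I ; cI = cI ; x = x ; y = y ; b = lab Bs
       ; eu = MX.perm-refl ; ev = PermProps.perm-refl EA ; rg = λ j → Node.rf (ch j) ; rf = Node.rf n }
    ch' : (p : Σ I (λ j → Idx (y j))) → TFG.Tree (lab (y (proj₁ p)) (proj₂ p))
    ch' p = Node.ch (ch (proj₁ p)) (proj₂ p)

  gNodeLeaves : ∀ {b} → GNode b → MSet (Car X)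
  gNodeLeaves n' = nodeLeaves {X} {A} {B} {g} {TFG.Tree} TFG.leaves n'

  fNodeLeaves′ : ∀ {a} → Node X B A f GNode a → MSet (Car X)
  fNodeLeaves′ n = nodeLeaves {X} {B} {A} {f} {GNode} gNodeLeaves n

  assemble-leaves : ∀ {a} (n : Node X B A f GNode a) → Perm X (TFG.leaves (assemble n)) (nodeLeaves {X} {B} {A} {f} {GNode} gNodeLeaves n)
  assemble-leaves n = s1 MX.■ s2 MX.■ s3
    where
    u0 = Node.u0 n
    Bs = Node.Bs n
    ch : (j : Idx Bs) → GNode (lab Bs j)
    ch = Node.ch n
    I = Idx Bs
    cI = cnt Bs
    x : I → MSet (Car X)
    x j = Node.u0 (ch j)
    y : I → MSet (Car A)
    y j = Node.Bs (ch j)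
    L : (j : I) → Idx (y j) → MSet (Car X)
    L j k = TFG.leaves (Node.ch (ch j) k)
    S1 = ΣM (Σ I (λ j → Idx (y j))) (countable-Σ cI (λ j → cnt (y j))) (λ p → L (proj₁ p) (proj₂ p))
    S2 = ΣM I cI (λ j → ΣM (Idx (y j)) (cnt (y j)) (λ k → L j k))
    s1 : Perm X ((u0 ⊕ ΣM I cI x) ⊕ S1) ((u0 ⊕ ΣM I cI x) ⊕ S2)
    s1 = Lift-⊕ MX.perm-refl (ΣM-assoc (≈-refl-at EX) {I = I} {c = cI} {J = λ j → Idx (y j)} {d = λ j → cnt (y j)} {F = λ p → L (proj₁ p) (proj₂ p)})
    s2 : Perm X ((u0 ⊕ ΣM I cI x) ⊕ S2) (u0 ⊕ (ΣM I cI x ⊕ S2))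
    s2 = ⊕-assoc (≈-refl-at EX) {u = u0} {v = ΣM I cI x} {w = S2}
    s3 : Perm X (u0 ⊕ (ΣM I cI x ⊕ S2)) (u0 ⊕ ΣM I cI (λ j → x j ⊕ ΣM (Idx (y j)) (cnt (y j)) (λ k → L j k)))
    s3 = Lift-⊕ MX.perm-refl (MX.perm-sym (ΣM-⊕ (≈-refl-at EX) {I = I} {c = cI} {F = x} {G = λ j → ΣM (Idx (y j)) (cnt (y j)) (λ k → L j k)}))

module StarSplit {X A B : Obj} (EX : IsSetoid X) (EA : IsSetoid A) (EB : IsSetoid B)
           (f : Hom (! X ⊗ ! B) A) (g : Hom (! X ⊗ ! A) B) (fm : IsMor f) (gm : IsMor g) where
  private
    fg = star X A B f g
    gf = star X B A g f
    module TFG = Trees X A fg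
    module TGF = Trees X B gf
    module MX = PermProps EX
    module AGF = StarAssemble EX EB EA g f
    rt : ∀ p a a' → _≈_ A a a' → R f p a → R f p a'
    rt p a a' = retarget {f = f} (isSetoid-!⊗! EX EB) fm

  FNode : Car A → Set₁
  FNode = Node X B A f TGF.Tree

  fNodeLeaves : ∀ {a} → FNode a → MSet (Car X)
  fNodeLeaves n = nodeLeaves {X} {B} {A} {f} {TGF.Tree} TGF.leaves n

  splitStar : ∀ {a} (t : TFG.Tree a) → Σ (FNode a) (λ n → Perm X (TFG.leaves t) (fNodeLeaves n))
  splitStar {a} (TFG.node u v p ts) = res , eq
    where
    d : StarView EX EA EB {f = f} {g = g} u v a
    d = star-elim EX EA EB {f = f} {g = g} p
    u0 = StarView.u0 d
    I = StarView.I d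
    cI = StarView.cI d
    x = StarView.x d
    y = StarView.y d
    b = StarView.b d
    ε = bij (StarView.ev d)
    rec : (i : Idx v) → Σ (FNode (lab v i)) (λ n → Perm X (TFG.leaves (ts i)) (fNodeLeaves n))
    rec i = splitStar (ts i)
    nd : (q : Σ I (λ j → Idx (y j))) → FNode (lab (y (proj₁ q)) (proj₂ q))
    nd q = retagNode rt {lab v (from ε q)} {lab (y (proj₁ q)) (proj₂ q)} (Lift-from (StarView.ev d) q) (proj₁ (rec (from ε q)))
    gn : (j : I) → Node X A B g FNode (b j)
    gn j = record { u0 = x j ; Bs = y j ; rf = StarView.rg d j ; ch = λ k → nd (j , k) }
    G : (j : I) → TGF.Tree (b j)
    G j = AGF.assemble (gn j)
    res : FNode a
    res = record { u0 = u0 ; Bs = mset I cI b ; rf = StarView.rf d ; ch = G }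
    NL : (q : Σ I (λ j → Idx (y j))) → MSet (Car X)
    NL q = fNodeLeaves (nd q)
    S0 = ΣM (Idx v) (cnt v) (λ i → fNodeLeaves (proj₁ (rec i)))
    S1 = ΣM (Σ I (λ j → Idx (y j))) (countable-Σ cI (λ j → cnt (y j))) NL
    S2 = ΣM I cI (λ j → ΣM (Idx (y j)) (cnt (y j)) (λ k → NL (j , k)))
    S3 = ΣM I cI (λ j → x j ⊕ ΣM (Idx (y j)) (cnt (y j)) (λ k → NL (j , k)))
    e1 : Perm X (TFG.leaves (TFG.node u v p ts)) ((u0 ⊕ ΣM I cI x) ⊕ S0)
    e1 = Lift-⊕ (StarView.eu d) (Lift-ΣM′ {c = cnt v} {F = λ i → TFG.leaves (ts i)} {G = λ i → fNodeLeaves (proj₁ (rec i))} (λ i → proj₂ (rec i)))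
    e2 : Perm X ((u0 ⊕ ΣM I cI x) ⊕ S0) ((u0 ⊕ ΣM I cI x) ⊕ S1)
    e2 = Lift-⊕ MX.perm-refl (ΣM-reidx (≈-refl-at EX) {c = cnt v} {d = countable-Σ cI (λ j → cnt (y j))} ε (λ i → fNodeLeaves (proj₁ (rec i))))
    e3 : Perm X ((u0 ⊕ ΣM I cI x) ⊕ S1) ((u0 ⊕ ΣM I cI x) ⊕ S2)
    e3 = Lift-⊕ MX.perm-refl (ΣM-assoc (≈-refl-at EX) {I = I} {c = cI} {J = λ j → Idx (y j)} {d = λ j → cnt (y j)} {F = NL})
    e4 : Perm X ((u0 ⊕ ΣM I cI x) ⊕ S2) (u0 ⊕ (ΣM I cI x ⊕ S2))
    e4 = ⊕-assoc (≈-refl-at EX) {u = u0} {v = ΣM I cI x} {w = S2}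
    e5 : Perm X (u0 ⊕ (ΣM I cI x ⊕ S2)) (u0 ⊕ S3)
    e5 = Lift-⊕ MX.perm-refl (MX.perm-sym (ΣM-⊕ (≈-refl-at EX) {I = I} {c = cI} {F = x} {G = λ j → ΣM (Idx (y j)) (cnt (y j)) (λ k → NL (j , k))}))
    al : (j : I) → Perm X (TGF.leaves (G j)) (x j ⊕ ΣM (Idx (y j)) (cnt (y j)) (λ k → NL (j , k)))
    al j = AGF.assemble-leaves (gn j)
    e6 : Perm X (u0 ⊕ S3) (fNodeLeaves res)
    e6 = Lift-⊕ MX.perm-refl (Lift-ΣM′ {c = cI} {F = λ j → x j ⊕ ΣM (Idx (y j)) (cnt (y j)) (λ k → NL (j , k))} {G = λ j → TGF.leaves (G j)}
                       (λ j → MX.perm-sym {TGF.leaves (G j)} {x j ⊕ ΣM (Idx (y j)) (cnt (y j)) (λ k → NL (j , k))} (al j)))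
    eq : Perm X (TFG.leaves (TFG.node u v p ts)) (fNodeLeaves res)
    eq = e1 MX.■ e2 MX.■ e3 MX.■ e4 MX.■ e5 MX.■ e6

module _ {X A B : Obj} (EX : IsSetoid X) (EA : IsSetoid A) (EB : IsSetoid B)
         (f : Hom (! X ⊗ ! B) A) (g : Hom (! X ⊗ ! A) B) (fm : IsMor f) (gm : IsMor g) where
  private
    fg = star X A B f g
    gf = star X B A g f
    module TFG = Trees X A fg
    module TGF = Trees X B gf
    module MX = PermProps EX
    module CFG = StarSplit EX EA EB f g fm gm
    module CGF = StarSplit EX EB EA g f gm fm
    module AFG = StarAssemble EX EA EB f g

  ind-law3 : Yind X A fg ≐ (f ∘ₕ (idₕ (! X) ⊗ₕ (!ₕ (Yind X B gf) ∘ₕ dig X)) ∘ₕ c X)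
  ind-law3 w a = to' , from'
    where
    to' : R (Yind X A fg) w a → R (unroll X B A f (Yind X B gf)) w a
    to' y = unroll-intro EX {f = f} {Y = Yind X B gf} {w = w} {u = Node.u0 n} {W = W} {V = Node.Bs n} {a = a}
              (proj₂ ty MX.■ proj₂ cv) (↔-refl , λ j → tree⇒Yind EX {f = gf} {TGF.leaves (Node.ch n j)} {lab (Node.Bs n) j} (Node.ch n j , MX.perm-refl)) (Node.rf n)
      where
      ty = Yind⇒tree EX {f = fg} {w} {a} y
      cv = CFG.splitStar (proj₁ ty)
      n = proj₁ cv
      W : MSet (MSet (Car X))
      W = mset (Idx (Node.Bs n)) (cnt (Node.Bs n)) (λ j → TGF.leaves (Node.ch n j))
    from' : R (unroll X B A f (Yind X B gf)) w a → R (Yind X A fg) w a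
    from' φ = tree⇒Yind EX {f = fg} {w} {a} (AFG.assemble n , e)
      where
      d = unroll-elim EX {f = f} {Y = Yind X B gf} φ
      u = UnrollView.u d
      W = UnrollView.W d
      V = UnrollView.V d
      τ = bij (UnrollView.lY d)
      ty : (j : Idx V) → Σ (TGF.Tree (lab V j)) (λ t → Perm X (lab W (from τ j)) (TGF.leaves t))
      ty j = Yind⇒tree EX {f = gf} (Lift-from (UnrollView.lY d) j)
      cj : (j : Idx V) → Σ (CGF.FNode (lab V j)) (λ n → Perm X (TGF.leaves (proj₁ (ty j))) (CGF.fNodeLeaves n))
      cj j = CGF.splitStar (proj₁ (ty j))
      n : Node X B A f AFG.GNode a
      n = record { u0 = u ; Bs = V ; rf = UnrollView.rf d ; ch = λ j → proj₁ (cj j) }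
      e1 : Perm X (ΣM (Idx W) (cnt W) (lab W)) (ΣM (Idx V) (cnt V) (λ j → lab W (from τ j)))
      e1 = ΣM-reidx (≈-refl-at EX) {c = cnt W} {d = cnt V} τ (lab W)
      e2 : Perm X (ΣM (Idx V) (cnt V) (λ j → lab W (from τ j))) (ΣM (Idx V) (cnt V) (λ j → CGF.fNodeLeaves (proj₁ (cj j))))
      e2 = Lift-ΣM′ {c = cnt V} {F = λ j → lab W (from τ j)} {G = λ j → CGF.fNodeLeaves (proj₁ (cj j))} (λ j → proj₂ (ty j) MX.■ proj₂ (cj j))
      e : Perm X w (TFG.leaves (AFG.assemble n))
      e = UnrollView.ew d MX.■ Lift-⊕ MX.perm-refl (e1 MX.■ e2) MX.■ MX.perm-sym {TFG.leaves (AFG.assemble n)} {AFG.fNodeLeaves′ n} (AFG.assemble-leaves n)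

regroup : ∀ {X A : Obj} (EX : IsSetoid X) (EA : IsSetoid A) {a : MSet (Car X)} {b : MSet (Car A)} {I c}
  (x : I → MSet (Car X)) (y : I → MSet (Car A)) →
  Perm (X & A) ((inl {X} {A} a ⊕ inr {X} {A} b) ⊕ ΣM I c (λ i → inl {X} {A} (x i) ⊕ inr {X} {A} (y i)))
             (inl {X} {A} (a ⊕ ΣM I c x) ⊕ inr {X} {A} (b ⊕ ΣM I c y))
regroup {X} {A} EX EA {a} {b} {I} {c} x y =
  Lift-⊕ M.perm-refl (ΣM-⊕ r {I = I} {c = c} {F = λ i → inl {X} {A} (x i)} {G = λ i → inr {X} {A} (y i)})
  M.■ ⊕-interchange r {a = inl {X} {A} a} {b = inr {X} {A} b} {c = ΣM I c (λ i → inl {X} {A} (x i))} {d = ΣM I c (λ i → inr {X} {A} (y i))}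
  M.■ Lift-⊕ (M.perm-sym (mapM-⊕ r {g = inj₁} {u = a} {v = ΣM I c x} M.■ Lift-⊕ M.perm-refl (mapM-ΣM r {g = inj₁} {I = I} {c = c} {F = x})))
          (M.perm-sym (mapM-⊕ r {g = inj₂} {u = b} {v = ΣM I c y} M.■ Lift-⊕ M.perm-refl (mapM-ΣM r {g = inj₂} {I = I} {c = c} {F = y})))
  where
  E = isSetoid-& EX EA
  module M = PermProps E
  r : ∀ a → sumEq X A a a
  r = ≈-refl-at E

module IndLaw4 {X A : Obj} (EX : IsSetoid X) (EA : IsSetoid A) (f : Hom ((! X ⊗ ! A) ⊗ ! A) A) (fm : IsMor f) where
  private
    EXA = isSetoid-& EX EA
    fInner = uncurryArg X A f
    fDiag = diagArg X A f
    fNested = Yind (X & A) A fInner ∘ₕ m X A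
    module TO = Trees X A fNested
    module TI = Trees (X & A) A fInner
    module T2 = Trees X A fDiag
    module MX = PermProps EX
    module MA = PermProps EA
    module MXA = PermProps EXA

  retarget-diag : ∀ p b b' → _≈_ A b b' → R fDiag p b → R fDiag p b'
  retarget-diag p b b' e r' = diagArg-intro EX EA {f = f} {u = proj₁ p} {v = proj₂ p} {b = b'} {v1 = DiagView.v1 d} {v2 = DiagView.v2 d}
      (retarget {f = f} (isSetoid-⊗ (isSetoid-!⊗! EX EA) (isSetoid-! EA)) fm e (DiagView.rf d)) (DiagView.ev d)
    where d = diagArg-elim EX EA {f = f} fm {proj₁ p} {proj₂ p} {b} r'

  view : ∀ {w v b} → R fInner (w , v) b → UncurryView EX EA {f = f} w v b
  view {w} {v} {b} p = uncurryArg-elim EX EA {f = f} fm {w} {v} {b} p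

  leavesX : ∀ {b} → TI.Tree b → MSet (Car X)
  leavesX {b} (TI.node w v p cs) = UncurryView.ux (view {w} {v} {b} p) ⊕ ΣM (Idx v) (cnt v) (λ i → leavesX (cs i))
  leavesA : ∀ {b} → TI.Tree b → MSet (Car A)
  leavesA {b} (TI.node w v p cs) = UncurryView.ua (view {w} {v} {b} p) ⊕ ΣM (Idx v) (cnt v) (λ i → leavesA (cs i))

  split-leaves : ∀ {b} (t : TI.Tree b) → Perm (X & A) (TI.leaves t) (inl {X} {A} (leavesX t) ⊕ inr {X} {A} (leavesA t))
  split-leaves {b} (TI.node w v p cs) =
    Lift-⊕ (UncurryView.ew (view {w} {v} {b} p))
           (Lift-ΣM′ {c = cnt v} {F = λ i → TI.leaves (cs i)}
                     {G = λ i → inl {X} {A} (leavesX (cs i)) ⊕ inr {X} {A} (leavesA (cs i))}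
                     (λ i → split-leaves (cs i)))
    MXA.■ regroup EX EA (λ i → leavesX (cs i)) (λ i → leavesA (cs i))

  graftDiag : ∀ {b} (t : TI.Tree b) (K : (l : Idx (leavesA t)) → T2.Tree (lab (leavesA t) l)) →
       Σ (T2.Tree b) (λ t' → Perm X (T2.leaves t') (leavesX t ⊕ ΣM (Idx (leavesA t)) (cnt (leavesA t)) (λ l → T2.leaves (K l))))
  graftDiag {b} (TI.node w v p cs) K = T2.node ux (ua ⊕ v) (diagArg-intro EX EA {f = f} {v1 = ua} {v2 = v} (UncurryView.rf d) MA.perm-refl) ch , eq
    where
    d = view {w} {v} {b} p
    ux = UncurryView.ux d
    ua = UncurryView.ua d
    rec : (i : Idx v) → _
    rec i = graftDiag (cs i) (λ l → K (inj₂ (i , l)))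
    ch : (z : Idx ua ⊎ Idx v) → T2.Tree (lab (ua ⊕ v) z)
    ch (inj₁ k) = K (inj₁ k)
    ch (inj₂ i) = proj₁ (rec i)
    Ka = ΣM (Idx ua) (cnt ua) (λ k → T2.leaves (K (inj₁ k)))
    LXi = λ i → leavesX (cs i)
    KK = λ i → ΣM (Idx (leavesA (cs i))) (cnt (leavesA (cs i))) (λ l → T2.leaves (K (inj₂ (i , l))))
    SX = ΣM (Idx v) (cnt v) LXi
    SK = ΣM (Idx v) (cnt v) KK
    s1 : Perm X (T2.leaves (T2.node ux (ua ⊕ v) (diagArg-intro EX EA {f = f} {v1 = ua} {v2 = v} (UncurryView.rf d) MA.perm-refl) ch))
              (ux ⊕ (Ka ⊕ ΣM (Idx v) (cnt v) (λ i → T2.leaves (proj₁ (rec i)))))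
    s1 = Lift-⊕ MX.perm-refl (ΣM-⊎ (≈-refl-at EX) {c = cnt ua} {d = cnt v} {F = λ z → T2.leaves (ch z)})
    s2 : Perm X (ux ⊕ (Ka ⊕ ΣM (Idx v) (cnt v) (λ i → T2.leaves (proj₁ (rec i))))) (ux ⊕ (Ka ⊕ ΣM (Idx v) (cnt v) (λ i → LXi i ⊕ KK i)))
    s2 = Lift-⊕ MX.perm-refl (Lift-⊕ MX.perm-refl (Lift-ΣM′ {c = cnt v} {F = λ i → T2.leaves (proj₁ (rec i))} {G = λ i → LXi i ⊕ KK i} (λ i → proj₂ (rec i))))
    s3 : Perm X (ux ⊕ (Ka ⊕ ΣM (Idx v) (cnt v) (λ i → LXi i ⊕ KK i))) (ux ⊕ (Ka ⊕ (SX ⊕ SK)))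
    s3 = Lift-⊕ MX.perm-refl (Lift-⊕ MX.perm-refl (ΣM-⊕ (≈-refl-at EX) {c = cnt v} {F = LXi} {G = KK}))
    s4 : Perm X (ux ⊕ (Ka ⊕ (SX ⊕ SK))) ((ux ⊕ SX) ⊕ (Ka ⊕ SK))
    s4 = MX.perm-sym (⊕-shuffle (≈-refl-at EX) {a = ux} {b = Ka} {c = SX} {d = SK})
    s5 : Perm X ((ux ⊕ SX) ⊕ (Ka ⊕ SK)) (leavesX (TI.node w v p cs) ⊕ ΣM (Idx (leavesA (TI.node w v p cs))) (cnt (leavesA (TI.node w v p cs))) (λ l → T2.leaves (K l)))
    s5 = Lift-⊕ MX.perm-refl (Lift-⊕ MX.perm-refl
           (MX.perm-sym (ΣM-assoc (≈-refl-at EX) {c = cnt v} {J = λ i → Idx (leavesA (cs i))}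
                                  {d = λ i → cnt (leavesA (cs i))} {F = λ q → T2.leaves (K (inj₂ q))}))
                     MX.■ MX.perm-sym (ΣM-⊎ (≈-refl-at EX) {c = cnt ua} {d = countable-Σ (cnt v) (λ i → cnt (leavesA (cs i)))} {F = λ l → T2.leaves (K l)}))
    eq = s1 MX.■ s2 MX.■ s3 MX.■ s4 MX.■ s5

  nested⇒diag : ∀ {b} (o : TO.Tree b) → Σ (T2.Tree b) (λ t → Perm X (TO.leaves o) (T2.leaves t))
  nested⇒diag {b} (TO.node u v (w' , mp , yi) os) = proj₁ flr , eq
    where
    ty = Yind⇒tree EXA {f = fInner} {w'} {b} yi
    i = proj₁ ty
    P : Perm (X & A) (inl {X} {A} u ⊕ inr {X} {A} v) (inl {X} {A} (leavesX i) ⊕ inr {X} {A} (leavesA i))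
    P = MXA.perm-sym (Σ⇒Lift {R = _≈_ (X & A)} {w'} {inl {X} {A} u ⊕ inr {X} {A} v} mp) MXA.■ proj₂ ty MXA.■ split-leaves i
    cc = cancel-inl⊕inr EX EA P
    ev = proj₂ cc
    β = bij ev
    rec : (l : Idx (leavesA i)) → Σ (T2.Tree (lab v (from β l))) (λ t → Perm X (TO.leaves (os (from β l))) (T2.leaves t))
    rec l = nested⇒diag (os (from β l))
    rec' : (l : Idx (leavesA i)) → Σ (T2.Tree (lab (leavesA i) l)) (λ t → Perm X (TO.leaves (os (from β l))) (T2.leaves t))
    rec' l = T2.retag retarget-diag {lab v (from β l)} {lab (leavesA i) l} (Lift-from ev l) {TO.leaves (os (from β l))} (rec l)
    K : (l : Idx (leavesA i)) → T2.Tree (lab (leavesA i) l)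
    K l = proj₁ (rec' l)
    flr = graftDiag i K
    s1 : Perm X (u ⊕ ΣM (Idx v) (cnt v) (λ j → TO.leaves (os j))) (leavesX i ⊕ ΣM (Idx (leavesA i)) (cnt (leavesA i)) (λ l → TO.leaves (os (from β l))))
    s1 = Lift-⊕ (proj₁ cc) (ΣM-reidx (≈-refl-at EX) {c = cnt v} {d = cnt (leavesA i)} β (λ j → TO.leaves (os j)))
    s2 : Perm X (leavesX i ⊕ ΣM (Idx (leavesA i)) (cnt (leavesA i)) (λ l → TO.leaves (os (from β l))))
                (leavesX i ⊕ ΣM (Idx (leavesA i)) (cnt (leavesA i)) (λ l → T2.leaves (K l)))
    s2 = Lift-⊕ MX.perm-refl (Lift-ΣM′ {c = cnt (leavesA i)} {F = λ l → TO.leaves (os (from β l))} {G = λ l → T2.leaves (K l)}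
           (λ l → proj₂ (rec' l)))
    eq = s1 MX.■ s2 MX.■ MX.perm-sym (proj₂ flr)

  record Gathered {b} (t : T2.Tree b) : Set₂ where
    field
      i  : TI.Tree b
      FX : MSet (Car X)
      FA : MSet (Car A)
      fr : (l : Idx FA) → TO.Tree (lab FA l)
      e1 : Perm (X & A) (TI.leaves i) (inl {X} {A} FX ⊕ inr {X} {A} FA)
      e2 : Perm X (T2.leaves t) (FX ⊕ ΣM (Idx FA) (cnt FA) (λ l → TO.leaves (fr l)))

  gather : ∀ {b} (t : T2.Tree b) → Gathered t
  diag⇒nested : ∀ {b} (t : T2.Tree b) → Σ (TO.Tree b) (λ o → Perm X (T2.leaves t) (TO.leaves o))

  gather {b} (T2.node u v p cs) = record { i = inner ; FX = FX ; FA = FA ; fr = fr ; e1 = e1 ; e2 = e2 }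
    where
    d = diagArg-elim EX EA {f = f} fm {u} {v} {b} p
    β = bij (DiagView.ev d)
    v1 = DiagView.v1 d
    v2 = DiagView.v2 d
    v1' = mset (Idx v1) (cnt v1) (λ m → lab v (from β (inj₁ m)))
    v2' = mset (Idx v2) (cnt v2) (λ k → lab v (from β (inj₂ k)))
    q1 : MsEq A v1 v1'
    q1 = ↔-refl , λ m → ≈-sym EA (Lift-from (DiagView.ev d) (inj₁ m))
    q2 : MsEq A v2 v2'
    q2 = ↔-refl , λ k → ≈-sym EA (Lift-from (DiagView.ev d) (inj₂ k))
    rf' : R f ((u , v1') , v2') b
    rf' = fm {(u , v1) , v2} {(u , v1') , v2'} {b} {b} ((≈-refl (isSetoid-! EX) {u} , q1) , q2) (≈-refl EA {b}) (DiagView.rf d)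
    sub : (k : Idx v2) → Gathered (cs (from β (inj₂ k)))
    sub k = gather (cs (from β (inj₂ k)))
    rec1 : (m : Idx v1) → Σ (TO.Tree (lab v1' m)) (λ o → Perm X (T2.leaves (cs (from β (inj₁ m)))) (TO.leaves o))
    rec1 m = diag⇒nested (cs (from β (inj₁ m)))
    inner : TI.Tree b
    inner = TI.node (inl {X} {A} u ⊕ inr {X} {A} v1') v2'
              (uncurryArg-intro EX EA {f = f} {w = inl {X} {A} u ⊕ inr {X} {A} v1'} {v = v2'} {b = b} {ux = u} {ua = v1'} rf' MXA.perm-refl)
              (λ k → Gathered.i (sub k))
    FXk = λ k → Gathered.FX (sub k)
    FAk = λ k → Gathered.FA (sub k)
    FX = u ⊕ ΣM (Idx v2) (cnt v2) FXk
    FA = v1' ⊕ ΣM (Idx v2) (cnt v2) FAk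
    fr : (l : Idx FA) → TO.Tree (lab FA l)
    fr (inj₁ m) = proj₁ (rec1 m)
    fr (inj₂ (k , l)) = Gathered.fr (sub k) l
    e1 : Perm (X & A) (TI.leaves inner) (inl {X} {A} FX ⊕ inr {X} {A} FA)
    e1 = Lift-⊕ MXA.perm-refl (Lift-ΣM′ {c = cnt v2} {F = λ k → TI.leaves (Gathered.i (sub k))}
                                         {G = λ k → inl {X} {A} (FXk k) ⊕ inr {X} {A} (FAk k)}
                                         (λ k → Gathered.e1 (sub k)))
         MXA.■ regroup EX EA {a = u} {b = v1'} FXk FAk
    Fa = ΣM (Idx v1) (cnt v1) (λ m → TO.leaves (fr (inj₁ m)))
    KK = λ k → ΣM (Idx (FAk k)) (cnt (FAk k)) (λ l → TO.leaves (Gathered.fr (sub k) l))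
    SX = ΣM (Idx v2) (cnt v2) FXk
    SK = ΣM (Idx v2) (cnt v2) KK
    s1 : Perm X (u ⊕ ΣM (Idx v) (cnt v) (λ j → T2.leaves (cs j)))
              (u ⊕ (ΣM (Idx v1) (cnt v1) (λ m → T2.leaves (cs (from β (inj₁ m)))) ⊕ ΣM (Idx v2) (cnt v2) (λ k → T2.leaves (cs (from β (inj₂ k))))))
    s1 = Lift-⊕ MX.perm-refl (ΣM-reidx (≈-refl-at EX) {c = cnt v} {d = countable-⊎ (cnt v1) (cnt v2)} β (λ j → T2.leaves (cs j))
                     MX.■ ΣM-⊎ (≈-refl-at EX) {c = cnt v1} {d = cnt v2} {F = λ z → T2.leaves (cs (from β z))})
    s2 : Perm X (u ⊕ (ΣM (Idx v1) (cnt v1) (λ m → T2.leaves (cs (from β (inj₁ m)))) ⊕ ΣM (Idx v2) (cnt v2) (λ k → T2.leaves (cs (from β (inj₂ k))))))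
              (u ⊕ (Fa ⊕ ΣM (Idx v2) (cnt v2) (λ k → FXk k ⊕ KK k)))
    s2 = Lift-⊕ MX.perm-refl (Lift-⊕ (Lift-ΣM′ {c = cnt v1} {F = λ m → T2.leaves (cs (from β (inj₁ m)))} {G = λ m → TO.leaves (fr (inj₁ m))} (λ m → proj₂ (rec1 m)))
                         (Lift-ΣM′ {c = cnt v2} {F = λ k → T2.leaves (cs (from β (inj₂ k)))} {G = λ k → FXk k ⊕ KK k} (λ k → Gathered.e2 (sub k))))
    s3 : Perm X (u ⊕ (Fa ⊕ ΣM (Idx v2) (cnt v2) (λ k → FXk k ⊕ KK k))) (u ⊕ (Fa ⊕ (SX ⊕ SK)))
    s3 = Lift-⊕ MX.perm-refl (Lift-⊕ MX.perm-refl (ΣM-⊕ (≈-refl-at EX) {c = cnt v2} {F = FXk} {G = KK}))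
    s4 : Perm X (u ⊕ (Fa ⊕ (SX ⊕ SK))) ((u ⊕ SX) ⊕ (Fa ⊕ SK))
    s4 = MX.perm-sym (⊕-shuffle (≈-refl-at EX) {a = u} {b = Fa} {c = SX} {d = SK})
    s5 : Perm X ((u ⊕ SX) ⊕ (Fa ⊕ SK)) (FX ⊕ ΣM (Idx FA) (cnt FA) (λ l → TO.leaves (fr l)))
    s5 = Lift-⊕ MX.perm-refl (Lift-⊕ MX.perm-refl
           (MX.perm-sym (ΣM-assoc (≈-refl-at EX) {c = cnt v2} {J = λ k → Idx (FAk k)}
                                  {d = λ k → cnt (FAk k)} {F = λ q → TO.leaves (fr (inj₂ q))}))
                     MX.■ MX.perm-sym (ΣM-⊎ (≈-refl-at EX) {c = cnt v1} {d = countable-Σ (cnt v2) (λ k → cnt (FAk k))} {F = λ l → TO.leaves (fr l)}))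
    e2 : Perm X (T2.leaves (T2.node u v p cs)) (FX ⊕ ΣM (Idx FA) (cnt FA) (λ l → TO.leaves (fr l)))
    e2 = s1 MX.■ s2 MX.■ s3 MX.■ s4 MX.■ s5

  diag⇒nested {b} t = TO.node (Gathered.FX G) (Gathered.FA G) p' (Gathered.fr G) , Gathered.e2 G
    where
    G = gather t
    p' : R fNested (Gathered.FX G , Gathered.FA G) b
    p' = TI.leaves (Gathered.i G) ,
         Lift⇒Σ {R = _≈_ (X & A)} {TI.leaves (Gathered.i G)} {inl {X} {A} (Gathered.FX G) ⊕ inr {X} {A} (Gathered.FA G)} (Gathered.e1 G) ,
         tree⇒Yind EXA {f = fInner} {TI.leaves (Gathered.i G)} {b} (Gathered.i G , MXA.perm-refl)

  ind-law4 : Yind X A fNested ≐ Yind X A fDiag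
  ind-law4 w a = (λ y → let ty = Yind⇒tree EX {f = fNested} {w} {a} y ; r = nested⇒diag (proj₁ ty) in
                        tree⇒Yind EX {f = fDiag} {w} {a} (proj₁ r , proj₂ ty MX.■ proj₂ r)) ,
                 (λ y → let ty = Yind⇒tree EX {f = fDiag} {w} {a} y ; r = diag⇒nested (proj₁ ty) in
                        tree⇒Yind EX {f = fNested} {w} {a} (proj₁ r , proj₂ ty MX.■ proj₂ r))

-- The coinductive fixpoint

record PathSystem : Set₁ where
  field
    St  : Set
    XI  : St → Set
    AI  : St → Set
    sub : (s : St) → AI s → St

module _ (P : PathSystem) where
  open PathSystem P
  data Path : St → Set where
    here  : ∀ {s} → XI s → Path s
    there : ∀ {s} (i : AI s) → Path (sub s i) → Path s

  endpoint : ∀ {s} → Path s → Σ St XI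
  endpoint (here {s} x) = s , x
  endpoint (there i l) = endpoint l

  opaque
    countable-Path : (∀ s → Countable (XI s)) → (∀ s → Countable (AI s)) → ∀ s → Countable (Path s)
    countable-Path cx ca s = code , injective
      where
      code : ∀ {s} → Path s → ℕ
      code (here {s} x) = parity (inj₁ (proj₁ (cx s) x))
      code (there {s} i l) = parity (inj₂ (pair (proj₁ (ca s) i) (code l)))
      injective : ∀ {s} {l l′ : Path s} → code l ≡ code l′ → l ≡ l′
      injective {s} {here x} {here y} e = cong here (proj₂ (cx s) (inj₁-injective (parity-injective e)))
      injective {s} {here x} {there i l′} e =
        ⊥-elim (even≢odd (proj₁ (cx s) x) (pair (proj₁ (ca s) i) (code l′)) e)
      injective {s} {there i l} {here y} e =
        ⊥-elim (even≢odd (proj₁ (cx s) y) (pair (proj₁ (ca s) i) (code l)) (sym e))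
      injective {s} {there i l} {there j l′} e
        with pair-injective _ _ _ _ (inj₂-injective (parity-injective e))
      ... | ei≡ej , e′ with proj₂ (ca s) ei≡ej
      ... | refl = cong (there i) (injective e′)

-- Like CoTree, but the label of a child and the corresponding entry of its
-- parent's multiset only agree up to ≈ (and the root only matches b up to ≈).
-- This is what makes grafting, rerooting and reindexing possible without transport;
-- CoTreeRun shows that nothing is lost when f is a morphism.
record RunSystem (X A : Obj) (f : Hom (! X ⊗ ! A) A) (b : Car A) : Set₁ where
  field
    St       : Set
    root     : St
    lb       : St → Car A
    xs       : St → MSet (Car X)
    as       : St → MSet (Car A)
    ok       : ∀ s → R f (xs s , as s) (lb s)
    sub      : ∀ s → Idx (as s) → St
    sub-lbl  : ∀ s i → _≈_ A (lb (sub s i)) (lab (as s) i)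
    root-lbl : _≈_ A (lb root) b

module _ {X A : Obj} {f : Hom (! X ⊗ ! A) A} {b : Car A} (P : RunSystem X A f b) where
  open RunSystem P
  pathSystem : PathSystem
  pathSystem = record { St = St ; XI = λ s → Idx (xs s) ; AI = λ s → Idx (as s) ; sub = sub }

  RunPath : St → Set
  RunPath = Path pathSystem

  runLeaves : St → MSet (Car X)
  runLeaves s = mset (RunPath s) (countable-Path pathSystem (λ s → cnt (xs s)) (λ s → cnt (as s)) s)
              (λ l → lab (xs (proj₁ (endpoint pathSystem l))) (proj₂ (endpoint pathSystem l)))

  runLeaves-unfold : ∀ {R : Car X → Car X → Set₁} → (∀ a → R a a) → ∀ s →
           Lift R (runLeaves s) (xs s ⊕ ΣM (Idx (as s)) (cnt (as s)) (λ i → runLeaves (sub s i)))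
  runLeaves-unfold rf s = Lift-reindex rf (mk↔ₛ′ t g tg gt) λ { (here x) → refl ; (there i l) → refl }
    where
    t : RunPath s → Idx (xs s) ⊎ Σ (Idx (as s)) (λ i → RunPath (sub s i))
    t (here x) = inj₁ x
    t (there i l) = inj₂ (i , l)
    g : Idx (xs s) ⊎ Σ (Idx (as s)) (λ i → RunPath (sub s i)) → RunPath s
    g (inj₁ x) = here x
    g (inj₂ (i , l)) = there i l
    tg : ∀ y → t (g y) ≡ y
    tg (inj₁ x) = refl
    tg (inj₂ (i , l)) = refl
    gt : ∀ y → g (t y) ≡ y
    gt (here x) = refl
    gt (there i l) = refl

  rerootAt : ∀ {b'} (s : St) → _≈_ A (lb s) b' → RunSystem X A f b'
  rerootAt s e = record { St = St ; root = s ; lb = lb ; xs = xs ; as = as ; ok = ok ; sub = sub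
                  ; sub-lbl = sub-lbl ; root-lbl = e }

YcoindRun : (X A : Obj) → Hom (! X ⊗ ! A) A → MSet (Car X) → Car A → Set₁
YcoindRun X A f w b = Σ (RunSystem X A f b) (λ P → Perm X w (runLeaves P (RunSystem.root P)))

module CoTreeRun {X A : Obj} (EX : IsSetoid X) (EA : IsSetoid A) {f : Hom (! X ⊗ ! A) A} where
  module RT = RunTrees X A f
  open RT using (CoTree)

  module _ {b : Car A} (t : CoTree b) where
    private module t = CoTree t
    Pt : RunSystem X A f b
    Pt = record { St = t.St ; root = t.root ; lb = t.lbl ; xs = t.xs ; as = t.as ; ok = t.ok ; sub = t.sub
                ; sub-lbl = λ s i → subst (λ z → _≈_ A (t.lbl (t.sub s i)) z) (t.sub-lbl s i) (≈-refl EA)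
                ; root-lbl = subst (λ z → _≈_ A (t.lbl t.root) z) t.root-lbl (≈-refl EA) }
    c2p : ∀ {s} → RT.CoLeafFrom t s → RunPath Pt s
    c2p (RT.here k) = here k
    c2p (RT.there i l) = there i (c2p l)
    p2c : ∀ {s} → RunPath Pt s → RT.CoLeafFrom t s
    p2c (here k) = RT.here k
    p2c (there i l) = RT.there i (p2c l)
    cp : ∀ {s} (l : RunPath Pt s) → c2p (p2c l) ≡ l
    cp (here k) = refl
    cp (there i l) = cong (there i) (cp l)
    pc : ∀ {s} (l : RT.CoLeafFrom t s) → p2c (c2p l) ≡ l
    pc (RT.here k) = refl
    pc (RT.there i l) = cong (RT.there i) (pc l)
    clab : ∀ {s} (l : RT.CoLeafFrom t s) → lab (runLeaves Pt s) (c2p l) ≡ RT.coLeafLabFrom t l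
    clab (RT.here k) = refl
    clab (RT.there i l) = clab l

  Ycoind⇒run : ∀ {w b} → R (Ycoind X A f) w b → YcoindRun X A f w b
  Ycoind⇒run {w} {b} (t , σ , h) = Pt t , (↔-trans σ (mk↔ₛ′ (c2p t) (p2c t) (cp t) (pc t)) ,
      λ k → subst (_≈_ X (lab w k)) (sym (clab t (to σ k))) (h k))

  module _ (fm : IsMor f) {b : Car A} (P : RunSystem X A f b) where
    private module P = RunSystem P
    ex : P.St → MSet (Car A)
    ex s = mset (Idx (P.as s)) (cnt (P.as s)) (λ i → P.lb (P.sub s i))
    exq : ∀ s → MsEq A (P.as s) (ex s)
    exq s = ↔-refl , λ i → ≈-sym EA (P.sub-lbl s i)
    St' = ⊤ ⊎ P.St
    lb' : St' → Car A
    lb' (inj₁ _) = b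
    lb' (inj₂ s) = P.lb s
    xs' : St' → MSet (Car X)
    xs' (inj₁ _) = P.xs P.root
    xs' (inj₂ s) = P.xs s
    as' : St' → MSet (Car A)
    as' (inj₁ _) = ex P.root
    as' (inj₂ s) = ex s
    ok' : ∀ s → R f (xs' s , as' s) (lb' s)
    ok' (inj₁ _) = fm {P.xs P.root , P.as P.root} {P.xs P.root , ex P.root} {P.lb P.root} {b}
                      (≈-refl (isSetoid-! EX) {P.xs P.root} , exq P.root) P.root-lbl (P.ok P.root)
    ok' (inj₂ s) = fm {P.xs s , P.as s} {P.xs s , ex s} {P.lb s} {P.lb s}
                      (≈-refl (isSetoid-! EX) {P.xs s} , exq s) (≈-refl EA) (P.ok s)
    sub' : ∀ s → Idx (as' s) → St'
    sub' (inj₁ _) i = inj₂ (P.sub P.root i)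
    sub' (inj₂ s) i = inj₂ (P.sub s i)
    sl' : ∀ s i → lb' (sub' s i) ≡ lab (as' s) i
    sl' (inj₁ _) i = refl
    sl' (inj₂ s) i = refl
    T' : CoTree b
    T' = record { St = St' ; root = inj₁ tt ; lbl = lb' ; root-lbl = refl ; xs = xs' ; as = as' ; ok = ok'
                ; sub = sub' ; sub-lbl = sl' }
    q2p : ∀ {s} → RT.CoLeafFrom T' (inj₂ s) → RunPath P s
    q2p (RT.here k) = here k
    q2p (RT.there i l) = there i (q2p l)
    p2q : ∀ {s} → RunPath P s → RT.CoLeafFrom T' (inj₂ s)
    p2q (here k) = RT.here k
    p2q (there i l) = RT.there i (p2q l)
    qp : ∀ {s} (l : RunPath P s) → q2p (p2q l) ≡ l
    qp (here k) = refl
    qp (there i l) = cong (there i) (qp l)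
    pq : ∀ {s} (l : RT.CoLeafFrom T' (inj₂ s)) → p2q (q2p l) ≡ l
    pq (RT.here k) = refl
    pq (RT.there i l) = cong (RT.there i) (pq l)
    qlab : ∀ {s} (l : RT.CoLeafFrom T' (inj₂ s)) → lab (runLeaves P s) (q2p l) ≡ RT.coLeafLabFrom T' l
    qlab (RT.here k) = refl
    qlab (RT.there i l) = qlab l
    r2p : RT.CoLeaf T' → RunPath P P.root
    r2p (RT.here k) = here k
    r2p (RT.there i l) = there i (q2p l)
    p2r : RunPath P P.root → RT.CoLeaf T'
    p2r (here k) = RT.here k
    p2r (there i l) = RT.there i (p2q l)
    rp : ∀ l → r2p (p2r l) ≡ l
    rp (here k) = refl
    rp (there i l) = cong (there i) (qp l)
    pr : ∀ l → p2r (r2p l) ≡ l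
    pr (RT.here k) = refl
    pr (RT.there i l) = cong (RT.there i) (pq l)
    rlab : ∀ l → lab (runLeaves P P.root) (r2p l) ≡ RT.coLeafLabFrom T' l
    rlab (RT.here k) = refl
    rlab (RT.there i l) = qlab l

  run⇒Ycoind : IsMor f → ∀ {w b} → YcoindRun X A f w b → R (Ycoind X A f) w b
  run⇒Ycoind fm {w} {b} (P , (σ , h)) = T' fm P , ↔-trans σ (↔-sym (mk↔ₛ′ (r2p fm P) (p2r fm P) (rp fm P) (pr fm P))) ,
      λ k → subst (_≈_ X (lab w k)) (trans (cong (lab (runLeaves P (RunSystem.root P))) (sym (rp fm P (to σ k)))) (rlab fm P (p2r fm P (to σ k)))) (h k)

module Graft {X A : Obj} (EX : IsSetoid X) (EA : IsSetoid A) {f : Hom (! X ⊗ ! A) A} {b : Car A}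
             (u : MSet (Car X)) (V : MSet (Car A)) (rf : R f (u , V) b)
             (P : (j : Idx V) → RunSystem X A f (lab V j)) where
  private
    module P (j : Idx V) = RunSystem (P j)
  St : Set
  St = ⊤ ⊎ Σ (Idx V) P.St
  lb : St → Car A
  lb (inj₁ _) = b
  lb (inj₂ (j , s)) = P.lb j s
  xs : St → MSet (Car X)
  xs (inj₁ _) = u
  xs (inj₂ (j , s)) = P.xs j s
  as : St → MSet (Car A)
  as (inj₁ _) = V
  as (inj₂ (j , s)) = P.as j s
  ok : ∀ s → R f (xs s , as s) (lb s)
  ok (inj₁ _) = rf
  ok (inj₂ (j , s)) = P.ok j s
  sub : ∀ s → Idx (as s) → St
  sub (inj₁ _) j = inj₂ (j , P.root j)
  sub (inj₂ (j , s)) i = inj₂ (j , P.sub j s i)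
  sl : ∀ s i → _≈_ A (lb (sub s i)) (lab (as s) i)
  sl (inj₁ _) j = P.root-lbl j
  sl (inj₂ (j , s)) i = P.sub-lbl j s i
  G : RunSystem X A f b
  G = record { St = St ; root = inj₁ tt ; lb = lb ; xs = xs ; as = as ; ok = ok ; sub = sub
             ; sub-lbl = sl ; root-lbl = ≈-refl EA }
  g2p : ∀ {j s} → RunPath G (inj₂ (j , s)) → RunPath (P j) s
  g2p (here k) = here k
  g2p (there i l) = there i (g2p l)
  p2g : ∀ {j s} → RunPath (P j) s → RunPath G (inj₂ (j , s))
  p2g (here k) = here k
  p2g (there i l) = there i (p2g l)
  gp : ∀ {j s} (l : RunPath (P j) s) → g2p (p2g l) ≡ l
  gp (here k) = refl
  gp (there i l) = cong (there i) (gp l)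
  pg : ∀ {j s} (l : RunPath G (inj₂ (j , s))) → p2g (g2p l) ≡ l
  pg (here k) = refl
  pg (there i l) = cong (there i) (pg l)
  glab : ∀ {j s} (l : RunPath G (inj₂ (j , s))) → lab (runLeaves (P j) s) (g2p l) ≡ lab (runLeaves G (inj₂ (j , s))) l
  glab (here k) = refl
  glab (there i l) = glab l

  graft-leaves : Perm X (runLeaves G (inj₁ tt)) (u ⊕ ΣM (Idx V) (cnt V) (λ j → runLeaves (P j) (P.root j)))
  graft-leaves = runLeaves-unfold G (≈-refl-at EX) (inj₁ tt) M.■
     Lift-⊕ M.perm-refl (Lift-ΣM′ {c = cnt V} {F = λ j → runLeaves G (inj₂ (j , P.root j))} {G = λ j → runLeaves (P j) (P.root j)}
        (λ j → mk↔ₛ′ g2p p2g gp pg , λ l → subst (_≈_ X (lab (runLeaves G (inj₂ (j , P.root j))) l)) (sym (glab l)) (≈-refl EX)))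
    where module M = PermProps EX

module _ {X A : Obj} (EX : IsSetoid X) (EA : IsSetoid A) where
  co-mor : (f : Hom (! X ⊗ ! A) A) → IsMor f → IsMor (Ycoind X A f)
  co-mor f fm {w} {w'} {a} {a'} ew ea y = CoTreeRun.run⇒Ycoind EX EA {f = f} fm {w'} {a'} (P' , M.perm-sym (Σ⇒Lift {R = _≈_ X} {w} {w'} ew) M.■ proj₂ cc)
    where
    module M = PermProps EX
    cc = CoTreeRun.Ycoind⇒run EX EA {f = f} {w} {a} y
    P = proj₁ cc
    P' : RunSystem X A f a'
    P' = record { St = RunSystem.St P ; root = RunSystem.root P ; lb = RunSystem.lb P ; xs = RunSystem.xs P ; as = RunSystem.as P ; ok = RunSystem.ok P
                ; sub = RunSystem.sub P ; sub-lbl = RunSystem.sub-lbl P ; root-lbl = ≈-trans EA (RunSystem.root-lbl P) ea }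

  Ycoind-mono : (f f' : Hom (! X ⊗ ! A) A) → IsMor f' → (∀ p b → R f p b → R f' p b) →
           ∀ {w a} → R (Ycoind X A f) w a → R (Ycoind X A f') w a
  Ycoind-mono f f' fm' ff {w} {a} y = CoTreeRun.run⇒Ycoind EX EA {f = f'} fm' {w} {a} (P' , proj₂ cc)
    where
    cc = CoTreeRun.Ycoind⇒run EX EA {f = f} {w} {a} y
    P = proj₁ cc
    P' : RunSystem X A f' a
    P' = record { St = RunSystem.St P ; root = RunSystem.root P ; lb = RunSystem.lb P ; xs = RunSystem.xs P ; as = RunSystem.as P
                ; ok = λ s → ff _ _ (RunSystem.ok P s)
                ; sub = RunSystem.sub P ; sub-lbl = RunSystem.sub-lbl P ; root-lbl = RunSystem.root-lbl P }

  co-eq : (f f' : Hom (! X ⊗ ! A) A) → IsMor f → IsMor f' → f ≐ f' → Ycoind X A f ≐ Ycoind X A f'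
  co-eq f f' fm fm' e w a = Ycoind-mono f f' fm' (λ p b → proj₁ (e p b)) {w} {a} , Ycoind-mono f' f fm (λ p b → proj₂ (e p b)) {w} {a}

  co-law2 : (f : Hom (! X ⊗ ! A) A) → IsMor f →
    Ycoind X A f ≐ (f ∘ₕ (idₕ (! X) ⊗ₕ (!ₕ (Ycoind X A f) ∘ₕ dig X)) ∘ₕ c X)
  co-law2 f fm w a = to' , from'
    where
    module M = PermProps EX
    to' : R (Ycoind X A f) w a → R (unroll X A A f (Ycoind X A f)) w a
    to' y = unroll-intro EX {f = f} {Y = Ycoind X A f} {w = w} {u = P.xs r} {W = W} {V = P.as r} {a = a}
              (proj₂ cc M.■ runLeaves-unfold P (≈-refl-at EX) r)
              (↔-refl , λ i → CoTreeRun.run⇒Ycoind EX EA {f = f} fm {runLeaves P (P.sub r i)} {lab (P.as r) i} (rerootAt P (P.sub r i) (P.sub-lbl r i) , M.perm-refl))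
              (retarget {f = f} (isSetoid-!⊗! EX EA) fm P.root-lbl (P.ok r))
      where
      cc = CoTreeRun.Ycoind⇒run EX EA {f = f} {w} {a} y
      P = proj₁ cc
      module P = RunSystem P
      r = P.root
      W : MSet (MSet (Car X))
      W = mset (Idx (P.as r)) (cnt (P.as r)) (λ i → runLeaves P (P.sub r i))
    from' : R (unroll X A A f (Ycoind X A f)) w a → R (Ycoind X A f) w a
    from' φ = CoTreeRun.run⇒Ycoind EX EA {f = f} fm {w} {a} (Graft.G EX EA u V (UnrollView.rf d) Pj , e)
      where
      d = unroll-elim EX {f = f} {Y = Ycoind X A f} φ
      u = UnrollView.u d
      W = UnrollView.W d
      V = UnrollView.V d
      τ = bij (UnrollView.lY d)
      cj : (j : Idx V) → YcoindRun X A f (lab W (from τ j)) (lab V j)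
      cj j = CoTreeRun.Ycoind⇒run EX EA {f = f} (Lift-from (UnrollView.lY d) j)
      Pj : (j : Idx V) → RunSystem X A f (lab V j)
      Pj j = proj₁ (cj j)
      e1 : Perm X (ΣM (Idx W) (cnt W) (lab W)) (ΣM (Idx V) (cnt V) (λ j → lab W (from τ j)))
      e1 = ΣM-reidx (≈-refl-at EX) {c = cnt W} {d = cnt V} τ (lab W)
      e2 : Perm X (ΣM (Idx V) (cnt V) (λ j → lab W (from τ j))) (ΣM (Idx V) (cnt V) (λ j → runLeaves (Pj j) (RunSystem.root (Pj j))))
      e2 = Lift-ΣM′ {c = cnt V} {F = λ j → lab W (from τ j)} {G = λ j → runLeaves (Pj j) (RunSystem.root (Pj j))} (λ j → proj₂ (cj j))
      e : Perm X w (runLeaves (Graft.G EX EA u V (UnrollView.rf d) Pj) (inj₁ tt))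
      e = UnrollView.ew d M.■ Lift-⊕ M.perm-refl (e1 M.■ e2)
          M.■ M.perm-sym {runLeaves (Graft.G EX EA u V (UnrollView.rf d) Pj) (inj₁ tt)}
                         {u ⊕ ΣM (Idx V) (cnt V) (λ j → runLeaves (Pj j) (RunSystem.root (Pj j)))}
                         (Graft.graft-leaves EX EA u V (UnrollView.rf d) Pj)

module Refine (St : Set) (AI : St → Set) (sub : ∀ s → AI s → St) (XP XQ : St → Set) where
  PP : PathSystem
  PP = record { St = St ; XI = XP ; AI = AI ; sub = sub }
  PQ : PathSystem
  PQ = record { St = St ; XI = XQ ; AI = AI ; sub = sub }

  module _ {C : Set₁} {Rr : C → C → Set₁} (lP : ∀ s → XP s → C) (F : ∀ s → XQ s → MSet C)
           (cP : ∀ s → Countable (Path PP s)) (cQ : ∀ s → Countable (Path PQ s)) (cQ0 : ∀ s → Countable (XQ s))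
           (cP0 : ∀ s → Countable (XP s))
           (e : ∀ s → Lift Rr (mset (XP s) (cP0 s) (lP s)) (ΣM (XQ s) (cQ0 s) (F s))) where
    φ : ∀ s → XP s ↔ Σ (XQ s) (λ y → Idx (F s y))
    φ s = bij (e s)
    Bk : ∀ {s} → Path PQ s → Set
    Bk l = Idx (F (proj₁ (endpoint PQ l)) (proj₂ (endpoint PQ l)))
    bto : ∀ {s} → Path PP s → Σ (Path PQ s) Bk
    bto (here {s} x) = here (proj₁ (to (φ s) x)) , proj₂ (to (φ s) x)
    bto (there i l) = there i (proj₁ (bto l)) , proj₂ (bto l)
    bfr : ∀ {s} → Σ (Path PQ s) Bk → Path PP s
    bfr (here {s} y , b) = here (from (φ s) (y , b))
    bfr (there i l , b) = there i (bfr (l , b))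
    btf : ∀ {s} (p : Σ (Path PQ s) Bk) → bto (bfr p) ≡ p
    btf (here {s} y , b) = cong (λ q → here (proj₁ q) , proj₂ q) (strictlyInverseˡ (φ s) (y , b))
    btf (there i l , b) = cong (λ q → there i (proj₁ q) , proj₂ q) (btf (l , b))
    bft : ∀ {s} (l : Path PP s) → bfr (bto l) ≡ l
    bft (here {s} x) = cong here (strictlyInverseʳ (φ s) x)
    bft (there i l) = cong (there i) (bft l)
    blab : ∀ {s} (l : Path PP s) →
           Rr (lP (proj₁ (endpoint PP l)) (proj₂ (endpoint PP l)))
              (lab (F (proj₁ (endpoint PQ (proj₁ (bto l)))) (proj₂ (endpoint PQ (proj₁ (bto l))))) (proj₂ (bto l)))
    blab (here {s} x) = lbl (e s) x
    blab (there i l) = blab l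

    refine : ∀ s → Lift Rr (mset (Path PP s) (cP s) (λ l → lP (proj₁ (endpoint PP l)) (proj₂ (endpoint PP l))))
                          (ΣM (Path PQ s) (cQ s) (λ l → F (proj₁ (endpoint PQ l)) (proj₂ (endpoint PQ l))))
    refine s = mk↔ₛ′ bto bfr btf bft , blab

-- Pairing each state with the path reaching it from r unshares the system, so data
-- chosen per leaf of the unfolded tree can be attached to states.
module Prefix (P : PathSystem) (r : PathSystem.St P) where
  open PathSystem P
  data Pre : St → Set where
    start : Pre r
    step  : ∀ {s} → Pre s → (i : AI s) → Pre (sub s i)

  cat : ∀ {s} → Pre s → Path P s → Path P r
  cat start l = l
  cat (step π i) l = cat π (there i l)

  cat-end : ∀ {s} (π : Pre s) (l : Path P s) → endpoint P (cat π l) ≡ endpoint P l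
  cat-end start l = refl
  cat-end (step π i) l = cat-end π (there i l)

  U : PathSystem
  U = record { St = Σ St Pre ; XI = λ p → XI (proj₁ p) ; AI = λ p → AI (proj₁ p) ; sub = λ p i → sub (proj₁ p) i , step (proj₂ p) i }

  ψ : ∀ {s π} → Path U (s , π) → Path P s
  ψ (here x) = here x
  ψ (there i l) = there i (ψ l)
  ψ⁻ : ∀ {s π} → Path P s → Path U (s , π)
  ψ⁻ (here x) = here x
  ψ⁻ (there i l) = there i (ψ⁻ l)
  ψψ : ∀ {s π} (l : Path P s) → ψ {s} {π} (ψ⁻ l) ≡ l
  ψψ (here x) = refl
  ψψ (there i l) = cong (there i) (ψψ l)
  ψψ' : ∀ {s π} (l : Path U (s , π)) → ψ⁻ (ψ l) ≡ l
  ψψ' (here x) = refl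
  ψψ' (there i l) = cong (there i) (ψψ' l)
  ψiso : ∀ {s π} → Path U (s , π) ↔ Path P s
  ψiso = mk↔ₛ′ ψ ψ⁻ ψψ ψψ'

  ψ-cat : ∀ {s π} (l : Path U (s , π)) →
          cat (proj₂ (proj₁ (endpoint U l))) (here (proj₂ (endpoint U l))) ≡ cat π (ψ l)
  ψ-cat (here x) = refl
  ψ-cat (there i l) = ψ-cat l

  ψ-end : ∀ {s π} (l : Path U (s , π)) → endpoint P (ψ l) ≡ (proj₁ (proj₁ (endpoint U l)) , proj₂ (endpoint U l))
  ψ-end (here x) = refl
  ψ-end (there i l) = ψ-end l

module _ {X Z A : Obj} (EX : IsSetoid X) (EZ : IsSetoid Z) (EA : IsSetoid A)
         (g : Hom (! X) Z) (f : Hom (! Z ⊗ ! A) A) (gm : IsMor g) (fm : IsMor f) where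
  private
    fg = precomp X Z A g f
    module MX = PermProps EX
    module MZ = PermProps EZ

  fg-mor : IsMor fg
  fg-mor {u , v} {u' , v'} {b} {b'} (eu , ev) eb r' =
    precomp-intro EX EZ EA {g = g} {f = f} {u = u'} {v = v'} {b = b'} {W = PrecompView.W d} {z = PrecompView.z d}
      (MX.perm-sym (Σ⇒Lift {R = _≈_ X} {u} {u'} eu) MX.■ PrecompView.eu d) (PrecompView.lg d)
      (fm {PrecompView.z d , v} {PrecompView.z d , v'} {b} {b'} (≈-refl (isSetoid-! EZ) {PrecompView.z d} , ev) eb (PrecompView.rf d))
    where d = precomp-elim EX EZ EA {g = g} {f = f} fm {u} {v} {b} r'

  co-law1 : Ycoind X A fg ≐ (Ycoind Z A f ∘ₕ !ₕ g ∘ₕ dig X)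
  co-law1 w a = to' , from'
    where
    to' : R (Ycoind X A fg) w a → R (Ycoind Z A f ∘ₕ !ₕ g ∘ₕ dig X) w a
    to' y = runLeaves D r , (W , Lift⇒Σ {R = _≈_ X} {w} {⨁ W} (proj₂ cc MX.■ blk) , Lift⇒Σ {R = R g} {W} {runLeaves D r} lgW) ,
            CoTreeRun.run⇒Ycoind EZ EA {f = f} fm {runLeaves D r} {a} (D , MZ.perm-refl)
      where
      cc = CoTreeRun.Ycoind⇒run EX EA {f = fg} {w} {a} y
      C = proj₁ cc
      module C = RunSystem C
      r = C.root
      d : ∀ s → PrecompView EX EZ EA {g = g} {f = f} (C.xs s) (C.as s) (C.lb s)
      d s = precomp-elim EX EZ EA {g = g} {f = f} fm {C.xs s} {C.as s} {C.lb s} (C.ok s)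
      D : RunSystem Z A f a
      D = record { St = C.St ; root = C.root ; lb = C.lb ; xs = λ s → PrecompView.z (d s) ; as = C.as
                 ; ok = λ s → PrecompView.rf (d s) ; sub = C.sub ; sub-lbl = C.sub-lbl ; root-lbl = C.root-lbl }
      τ = λ s → bij (PrecompView.lg (d s))
      F : ∀ s → Idx (PrecompView.z (d s)) → MSet (Car X)
      F s x = lab (PrecompView.W (d s)) (from (τ s) x)
      es : ∀ s → Perm X (mset (Idx (C.xs s)) (cnt (C.xs s)) (lab (C.xs s))) (ΣM (Idx (PrecompView.z (d s))) (cnt (PrecompView.z (d s))) (F s))
      es s = PrecompView.eu (d s) MX.■ ΣM-reidx (≈-refl-at EX) {c = cnt (PrecompView.W (d s))} {d = cnt (PrecompView.z (d s))} (τ s) (lab (PrecompView.W (d s)))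
      module B = Refine C.St (λ s → Idx (C.as s)) C.sub (λ s → Idx (C.xs s)) (λ s → Idx (PrecompView.z (d s)))
      blk = B.refine {Rr = _≈_ X} (λ s → lab (C.xs s)) F
              (countable-Path (pathSystem C) (λ s → cnt (C.xs s)) (λ s → cnt (C.as s)))
              (countable-Path (pathSystem D) (λ s → cnt (PrecompView.z (d s))) (λ s → cnt (C.as s)))
              (λ s → cnt (PrecompView.z (d s))) (λ s → cnt (C.xs s)) es r
      W : MSet (MSet (Car X))
      W = mset (RunPath D r) (cnt (runLeaves D r)) (λ l → F (proj₁ (endpoint (pathSystem D) l)) (proj₂ (endpoint (pathSystem D) l)))
      lgW : Lift (R g) W (runLeaves D r)
      lgW = ↔-refl , λ l → Lift-from (PrecompView.lg (d (proj₁ (endpoint (pathSystem D) l)))) (proj₂ (endpoint (pathSystem D) l))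
    from' : R (Ycoind Z A f ∘ₕ !ₕ g ∘ₕ dig X) w a → R (Ycoind X A fg) w a
    from' (z , (W , dg , lg) , y) = CoTreeRun.run⇒Ycoind EX EA {f = fg} (λ {p} {p'} {q} {q'} → fg-mor {p} {p'} {q} {q'}) {w} {a} (C , e)
      where
      cc = CoTreeRun.Ycoind⇒run EZ EA {f = f} {z} {a} y
      D = proj₁ cc
      module D = RunSystem D
      r = D.root
      lg' : Lift (R g) W (runLeaves D r)
      lg' = Lift-trans (λ {x} {y} {z} r' e → gm {x} {x} {y} {z} (≈-refl (isSetoid-! EX) {x}) e r') (Σ⇒Lift {R = R g} {W} {z} lg) (proj₂ cc)
      τ = bij lg'
      Fp : RunPath D r → MSet (Car X)
      Fp l = lab W (from τ l)
      open Prefix (pathSystem D) r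
      hk : ∀ {s} (π : Pre s) (k : Idx (D.xs s)) → R g (Fp (cat π (here k))) (lab (D.xs s) k)
      hk {s} π k = subst (λ p → R g (Fp (cat π (here k))) (lab (D.xs (proj₁ p)) (proj₂ p))) (cat-end π (here k)) (Lift-from lg' (cat π (here k)))
      xsC : Σ D.St Pre → MSet (Car X)
      xsC (s , π) = ΣM (Idx (D.xs s)) (cnt (D.xs s)) (λ k → Fp (cat π (here k)))
      okC : ∀ p → R fg (xsC p , D.as (proj₁ p)) (D.lb (proj₁ p))
      okC (s , π) = precomp-intro EX EZ EA {g = g} {f = f} {u = xsC (s , π)} {v = D.as s} {b = D.lb s}
                      {W = mset (Idx (D.xs s)) (cnt (D.xs s)) (λ k → Fp (cat π (here k)))} {z = D.xs s}
                      MX.perm-refl (↔-refl , hk π) (D.ok s)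
      C : RunSystem X A fg a
      C = record { St = Σ D.St Pre ; root = r , start ; lb = λ p → D.lb (proj₁ p) ; xs = xsC ; as = λ p → D.as (proj₁ p)
                 ; ok = okC ; sub = λ p i → D.sub (proj₁ p) i , step (proj₂ p) i
                 ; sub-lbl = λ p i → D.sub-lbl (proj₁ p) i ; root-lbl = D.root-lbl }
      F' : (p : Σ D.St Pre) → Idx (D.xs (proj₁ p)) → MSet (Car X)
      F' (s , π) k = Fp (cat π (here k))
      module B = Refine (Σ D.St Pre) (λ p → Idx (D.as (proj₁ p))) (λ p i → D.sub (proj₁ p) i , step (proj₂ p) i)
                       (λ p → Idx (xsC p)) (λ p → Idx (D.xs (proj₁ p)))
      blk = B.refine {Rr = _≈_ X} (λ p → lab (xsC p)) F'
              (countable-Path (pathSystem C) (λ p → cnt (xsC p)) (λ p → cnt (D.as (proj₁ p))))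
              (countable-Path U (λ p → cnt (D.xs (proj₁ p))) (λ p → cnt (D.as (proj₁ p))))
              (λ p → cnt (D.xs (proj₁ p))) (λ p → cnt (xsC p)) (λ p → MX.perm-refl) (r , start)
      e2 : Perm X (ΣM (Path U (r , start)) (countable-Path U (λ p → cnt (D.xs (proj₁ p))) (λ p → cnt (D.as (proj₁ p))) (r , start))
                    (λ l → F' (proj₁ (endpoint U l)) (proj₂ (endpoint U l))))
                (ΣM (RunPath D r) (cnt (runLeaves D r)) Fp)
      e2 = Lift-ΣM {c = countable-Path U (λ p → cnt (D.xs (proj₁ p))) (λ p → cnt (D.as (proj₁ p))) (r , start)} {d = cnt (runLeaves D r)}
               {F = λ l → F' (proj₁ (endpoint U l)) (proj₂ (endpoint U l))} {G = Fp} ψiso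
               (λ l → subst (λ q → Perm X (F' (proj₁ (endpoint U l)) (proj₂ (endpoint U l))) (Fp q)) (ψ-cat l) MX.perm-refl)
      e : Perm X w (runLeaves C (r , start))
      e = Σ⇒Lift {R = _≈_ X} {w} {⨁ W} dg MX.■ ΣM-reidx (≈-refl-at EX) {c = cnt W} {d = cnt (runLeaves D r)} τ (lab W)
          MX.■ MX.perm-sym e2 MX.■ MX.perm-sym blk

module Reidx (St : Set) (XI XI' AI AI' : St → Set) (αX : ∀ s → XI' s ↔ XI s) (αA : ∀ s → AI' s ↔ AI s)
             (sub : ∀ s → AI s → St) where
  P : PathSystem
  P = record { St = St ; XI = XI ; AI = AI ; sub = sub }
  P' : PathSystem
  P' = record { St = St ; XI = XI' ; AI = AI' ; sub = λ s q → sub s (to (αA s) q) }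

  rto : ∀ {s} → Path P' s → Path P s
  rto (here {s} x) = here (to (αX s) x)
  rto (there {s} q l) = there (to (αA s) q) (rto l)

  rfr : ∀ {s} → Path P s → Path P' s
  rfr (here {s} x) = here (from (αX s) x)
  rfr (there {s} i l) = there (from (αA s) i) (subst (Path P') (sym (cong (sub s) (strictlyInverseˡ (αA s) i))) (rfr l))

  private
    rto-subst : ∀ {s s'} (e : s ≡ s') (l : Path P' s) → rto (subst (Path P') e l) ≡ subst (Path P) e (rto l)
    rto-subst refl l = refl
    lemA : ∀ {s} {i i' : AI s} (h : i' ≡ i) (l : Path P (sub s i)) →
           there i' (subst (Path P) (sym (cong (sub s) h)) l) ≡ there i l
    lemA refl l = refl
    lemB : ∀ {s} {q q' : AI' s} (h : q' ≡ q) (e : sub s (to (αA s) q') ≡ sub s (to (αA s) q)) (l : Path P' (sub s (to (αA s) q))) →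
           _≡_ {A = Path P' s} (there q' (subst (Path P') (sym e) l)) (there q l)
    lemB refl refl l = refl

  rtf : ∀ {s} (l : Path P s) → rto (rfr l) ≡ l
  rtf (here {s} x) = cong here (strictlyInverseˡ (αX s) x)
  rtf (there {s} i l) = trans (cong (there (to (αA s) (from (αA s) i))) (trans (rto-subst (sym (cong (sub s) (strictlyInverseˡ (αA s) i))) (rfr l))
                                (cong (subst (Path P) (sym (cong (sub s) (strictlyInverseˡ (αA s) i)))) (rtf l))))
                              (lemA (strictlyInverseˡ (αA s) i) l)
  rft : ∀ {s} (l : Path P' s) → rfr (rto l) ≡ l
  rft (here {s} x) = cong here (strictlyInverseʳ (αX s) x)
  rft (there {s} q l) = trans (cong (λ z → there (from (αA s) (to (αA s) q)) (subst (Path P') (sym (cong (sub s) (strictlyInverseˡ (αA s) (to (αA s) q)))) z)) (rft l))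
                              (lemB (strictlyInverseʳ (αA s) q) (cong (sub s) (strictlyInverseˡ (αA s) (to (αA s) q))) l)

  riso : ∀ {s} → Path P' s ↔ Path P s
  riso = mk↔ₛ′ rto rfr rtf rft

  module _ {C : Set₁} {Rr : C → C → Set₁} (lX : ∀ s → XI s → C) (lX' : ∀ s → XI' s → C)
           (h : ∀ s x → Rr (lX' s x) (lX s (to (αX s) x))) where
    rlab : ∀ {s} (l : Path P' s) → Rr (lX' (proj₁ (endpoint P' l)) (proj₂ (endpoint P' l))) (lX (proj₁ (endpoint P (rto l))) (proj₂ (endpoint P (rto l))))
    rlab (here {s} x) = h s x
    rlab (there q l) = rlab l
    reidx : ∀ s (c' : Countable (Path P' s)) (c : Countable (Path P s)) →
            Lift Rr (mset (Path P' s) c' (λ l → lX' (proj₁ (endpoint P' l)) (proj₂ (endpoint P' l))))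
                    (mset (Path P s) c (λ l → lX (proj₁ (endpoint P l)) (proj₂ (endpoint P l))))
    reidx s c' c = riso , rlab

star-mor : ∀ {X A B : Obj} (EX : IsSetoid X) (EA : IsSetoid A) (EB : IsSetoid B) {f : Hom (! X ⊗ ! B) A} {g : Hom (! X ⊗ ! A) B} →
           IsMor f → IsMor (star X A B f g)
star-mor {X} {A} {B} EX EA EB {f} {g} fm {u , v} {u' , v'} {a} {a'} (eu , ev) ea r' =
  star-intro EX EA EB {f = f} {g = g} {u'} {v'} {a'} record
    { u0 = StarView.u0 d ; I = StarView.I d ; cI = StarView.cI d ; x = StarView.x d ; y = StarView.y d ; b = StarView.b d
    ; eu = PermProps.perm-sym EX (Σ⇒Lift {R = _≈_ X} {u} {u'} eu) MX.■ StarView.eu d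
    ; ev = PermProps.perm-sym EA (Σ⇒Lift {R = _≈_ A} {v} {v'} ev) MA.■ StarView.ev d
    ; rg = StarView.rg d
    ; rf = retarget {f = f} (isSetoid-!⊗! EX EB) fm ea (StarView.rf d) }
  where
  d = star-elim EX EA EB {f = f} {g = g} {u} {v} {a} r'
  module MX = PermProps EX
  module MA = PermProps EA

module CoStarSplit {X A B : Obj} (EX : IsSetoid X) (EA : IsSetoid A) (EB : IsSetoid B)
             (f : Hom (! X ⊗ ! B) A) (g : Hom (! X ⊗ ! A) B) (fm : IsMor f)
             {a : Car A} (C : RunSystem X A (star X A B f g) a) where
  private
    fg = star X A B f g
    gf = star X B A g f
    module C = RunSystem C
    module MX = PermProps EX
  St = C.St
  opaque
    d : ∀ s → StarView EX EA EB {f = f} {g = g} (C.xs s) (C.as s) (C.lb s)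
    d s = star-elim EX EA EB {f = f} {g = g} {C.xs s} {C.as s} {C.lb s} (C.ok s)
  u0 = λ s → StarView.u0 (d s)
  I = λ s → StarView.I (d s)
  cI = λ s → StarView.cI (d s)
  x = λ s → StarView.x (d s)
  y = λ s → StarView.y (d s)
  b = λ s → StarView.b (d s)
  ε : ∀ s → Idx (C.as s) ↔ Σ (I s) (λ j → Idx (y s j))
  ε s = bij (StarView.ev (d s))
  xs' : St → MSet (Car X)
  xs' s = u0 s ⊕ ΣM (I s) (cI s) (x s)
  as' : St → MSet (Car A)
  as' s = ΣM (I s) (cI s) (y s)
  sub' : ∀ s → Idx (as' s) → St
  sub' s q = C.sub s (from (ε s) q)
  C' : RunSystem X A fg a
  C' = record { St = St ; root = C.root ; lb = C.lb ; xs = xs' ; as = as'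
              ; ok = λ s → star-intro EX EA EB {f = f} {g = g} {xs' s} {as' s} {C.lb s} record
                      { u0 = u0 s ; I = I s ; cI = cI s ; x = x s ; y = y s ; b = b s ; eu = MX.perm-refl ; ev = PermProps.perm-refl EA
                      ; rg = StarView.rg (d s) ; rf = StarView.rf (d s) }
              ; sub = sub'
              ; sub-lbl = λ s q → ≈-trans EA (C.sub-lbl s (from (ε s) q)) (Lift-from (StarView.ev (d s)) q)
              ; root-lbl = C.root-lbl }
  module RI = Reidx St (λ s → Idx (C.xs s)) (λ s → Idx (xs' s)) (λ s → Idx (C.as s)) (λ s → Idx (as' s))
                    (λ s → ↔-sym (bij (StarView.eu (d s)))) (λ s → ↔-sym (ε s)) C.sub
  norm : ∀ s → Perm X (runLeaves C s) (runLeaves C' s)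
  norm s = MX.perm-sym (RI.reidx {Rr = _≈_ X} (λ s → lab (C.xs s)) (λ s → lab (xs' s))
                     (λ s z → ≈-sym EX (Lift-from (StarView.eu (d s)) z)) s
                     (countable-Path (pathSystem C') (λ s → cnt (xs' s)) (λ s → cnt (as' s)) s)
                     (countable-Path (pathSystem C) (λ s → cnt (C.xs s)) (λ s → cnt (C.as s)) s))

  s' : ∀ s j → Idx (y s j) → St
  s' s j k = sub' s (j , k)
  StD = Σ St I
  xsD : StD → MSet (Car X)
  xsD p = x (proj₁ p) (proj₂ p) ⊕ ΣM (Idx (y (proj₁ p) (proj₂ p))) (cnt (y (proj₁ p) (proj₂ p))) (λ k → u0 (s' (proj₁ p) (proj₂ p) k))
  asD : StD → MSet (Car B)
  asD p = ΣM (Idx (y (proj₁ p) (proj₂ p))) (cnt (y (proj₁ p) (proj₂ p)))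
             (λ k → mset (I (s' (proj₁ p) (proj₂ p) k)) (cI (s' (proj₁ p) (proj₂ p) k)) (b (s' (proj₁ p) (proj₂ p) k)))
  lbD : StD → Car B
  lbD p = b (proj₁ p) (proj₂ p)
  okD : ∀ p → R gf (xsD p , asD p) (lbD p)
  okD (s , j) = star-intro EX EB EA {f = g} {g = f} {xsD (s , j)} {asD (s , j)} {lbD (s , j)} record
    { u0 = x s j ; I = Idx (y s j) ; cI = cnt (y s j) ; x = λ k → u0 (s' s j k)
    ; y = λ k → mset (I (s' s j k)) (cI (s' s j k)) (b (s' s j k)) ; b = lab (y s j)
    ; eu = MX.perm-refl ; ev = PermProps.perm-refl EB
    ; rg = λ k → retarget {f = f} (isSetoid-!⊗! EX EB) fm (RunSystem.sub-lbl C' s (j , k)) (StarView.rf (d (s' s j k)))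
    ; rf = StarView.rg (d s) j }
  subD : ∀ p → Idx (asD p) → StD
  subD (s , j) (k , j') = s' s j k , j'
  gfRunAt : ∀ p → RunSystem X B gf (lbD p)
  gfRunAt p = record { St = StD ; root = p ; lb = lbD ; xs = xsD ; as = asD ; ok = okD ; sub = subD
                   ; sub-lbl = λ p q → ≈-refl EB ; root-lbl = ≈-refl EB }
  gfPaths : PathSystem
  gfPaths = record { St = StD ; XI = λ p → Idx (xsD p) ; AI = λ p → Idx (asD p) ; sub = subD }
  gfLeaves : StD → MSet (Car X)
  gfLeaves p = mset (Path gfPaths p) (countable-Path gfPaths (λ p → cnt (xsD p)) (λ p → cnt (asD p)) p)
              (λ l → lab (xsD (proj₁ (endpoint gfPaths l))) (proj₂ (endpoint gfPaths l)))

  DP : StD → Set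
  DP p = Path gfPaths p
  Tgt : St → Set
  Tgt s = Idx (u0 s) ⊎ Σ (I s) (λ j → DP (s , j))
  toT : ∀ {s} j k → Tgt (s' s j k) → Tgt s
  toT j k (inj₁ u) = inj₂ (j , here (inj₂ (k , u)))
  toT j k (inj₂ (j' , l')) = inj₂ (j , there (k , j') l')
  cto : ∀ {s} → RunPath C' s → Tgt s
  cto (here (inj₁ u)) = inj₁ u
  cto (here (inj₂ (j , z))) = inj₂ (j , here (inj₁ z))
  cto (there (j , k) l) = toT j k (cto l)
  frD : ∀ {s j} → DP (s , j) → RunPath C' s
  frD {s} {j} (here (inj₁ z)) = here (inj₂ (j , z))
  frD {s} {j} (here (inj₂ (k , u))) = there (j , k) (here (inj₁ u))
  frD {s} {j} (there (k , j') l') = there (j , k) (frD l')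
  cfr : ∀ {s} → Tgt s → RunPath C' s
  cfr (inj₁ u) = here (inj₁ u)
  cfr (inj₂ (j , p)) = frD p
  ctfD : ∀ {s j} (p : DP (s , j)) → cto (frD p) ≡ inj₂ (j , p)
  ctfD (here (inj₁ z)) = refl
  ctfD (here (inj₂ (k , u))) = refl
  ctfD {s} {j} (there (k , j') l') = cong (toT j k) (ctfD l')
  ctf : ∀ {s} (z : Tgt s) → cto (cfr z) ≡ z
  ctf (inj₁ u) = refl
  ctf (inj₂ (j , p)) = ctfD p
  frT : ∀ {s} j k (z : Tgt (s' s j k)) → cfr (toT j k z) ≡ there (j , k) (cfr z)
  frT j k (inj₁ u) = refl
  frT j k (inj₂ (j' , l')) = refl
  cft : ∀ {s} (l : RunPath C' s) → cfr (cto l) ≡ l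
  cft (here (inj₁ u)) = refl
  cft (here (inj₂ (j , z))) = refl
  cft (there (j , k) l) = trans (frT j k (cto l)) (cong (there (j , k)) (cft l))

  tgtM : St → MSet (Car X)
  tgtM s = u0 s ⊕ ΣM (I s) (cI s) (λ j → gfLeaves (s , j))
  tlabT : ∀ {s} j k (z : Tgt (s' s j k)) → lab (tgtM s) (toT j k z) ≡ lab (tgtM (s' s j k)) z
  tlabT j k (inj₁ u) = refl
  tlabT j k (inj₂ (j' , l')) = refl
  clab : ∀ {s} (l : RunPath C' s) → lab (tgtM s) (cto l) ≡ lab (runLeaves C' s) l
  clab (here (inj₁ u)) = refl
  clab (here (inj₂ (j , z))) = refl
  clab (there (j , k) l) = trans (tlabT j k (cto l)) (clab l)

  convM : ∀ s → Perm X (runLeaves C' s) (tgtM s)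
  convM s = Lift-reindex (≈-refl-at EX) (mk↔ₛ′ cto cfr ctf cft) clab

  convLv : ∀ s → Perm X (runLeaves C s) (tgtM s)
  convLv s = norm s MX.■ convM s

module _ {X A B : Obj} (EX : IsSetoid X) (EA : IsSetoid A) (EB : IsSetoid B)
         (f : Hom (! X ⊗ ! B) A) (g : Hom (! X ⊗ ! A) B) (fm : IsMor f) (gm : IsMor g) where
  private
    fg = star X A B f g
    gf = star X B A g f
    module MX = PermProps EX
    fgm : IsMor fg
    fgm {p} {p'} {q} {q'} = star-mor EX EA EB {f = f} {g = g} fm {p} {p'} {q} {q'}
    gfm : IsMor gf
    gfm {p} {p'} {q} {q'} = star-mor EX EB EA {f = g} {g = f} gm {p} {p'} {q} {q'}

  co-law3 : Ycoind X A fg ≐ (f ∘ₕ (idₕ (! X) ⊗ₕ (!ₕ (Ycoind X B gf) ∘ₕ dig X)) ∘ₕ c X)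
  co-law3 w a = to' , from'
    where
    to' : R (Ycoind X A fg) w a → R (unroll X B A f (Ycoind X B gf)) w a
    to' y = unroll-intro EX {f = f} {Y = Ycoind X B gf} {w = w} {u = K.u0 r} {W = W} {V = V} {a = a}
              (proj₂ cc MX.■ K.convLv r)
              (↔-refl , λ j → CoTreeRun.run⇒Ycoind EX EB {f = gf} (λ {p} {p'} {q} {q'} → gfm {p} {p'} {q} {q'}) {K.gfLeaves (r , j)} {K.b r j} (K.gfRunAt (r , j) , MX.perm-refl))
              (retarget {f = f} (isSetoid-!⊗! EX EB) fm C.root-lbl (StarView.rf (K.d r)))
      where
      cc = CoTreeRun.Ycoind⇒run EX EA {f = fg} {w} {a} y
      C = proj₁ cc
      module C = RunSystem C
      module K = CoStarSplit EX EA EB f g fm C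
      r = C.root
      W : MSet (MSet (Car X))
      W = mset (K.I r) (K.cI r) (λ j → K.gfLeaves (r , j))
      V : MSet (Car B)
      V = mset (K.I r) (K.cI r) (K.b r)
    from' : R (unroll X B A f (Ycoind X B gf)) w a → R (Ycoind X A fg) w a
    from' φ = CoTreeRun.run⇒Ycoind EX EA {f = fg} (λ {p} {p'} {q} {q'} → fgm {p} {p'} {q} {q'}) {w} {a} (GG , e)
      where
      dd = unroll-elim EX {f = f} {Y = Ycoind X B gf} φ
      u = UnrollView.u dd
      W = UnrollView.W dd
      V = UnrollView.V dd
      τ = bij (UnrollView.lY dd)
      cj : (j : Idx V) → YcoindRun X B gf (lab W (from τ j)) (lab V j)
      cj j = CoTreeRun.Ycoind⇒run EX EB {f = gf} (Lift-from (UnrollView.lY dd) j)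
      Pj : (j : Idx V) → RunSystem X B gf (lab V j)
      Pj j = proj₁ (cj j)
      module K (j : Idx V) = CoStarSplit EX EB EA g f gm (Pj j)
      rj : (j : Idx V) → RunSystem.St (Pj j)
      rj j = RunSystem.root (Pj j)
      x : Idx V → MSet (Car X)
      x j = K.u0 j (rj j)
      y : Idx V → MSet (Car A)
      y j = mset (K.I j (rj j)) (K.cI j (rj j)) (K.b j (rj j))
      xs★ = u ⊕ ΣM (Idx V) (cnt V) x
      as★ = ΣM (Idx V) (cnt V) y
      ok★ : R fg (xs★ , as★) a
      ok★ = star-intro EX EA EB {f = f} {g = g} {xs★} {as★} {a} record
        { u0 = u ; I = Idx V ; cI = cnt V ; x = x ; y = y ; b = lab V ; eu = MX.perm-refl ; ev = PermProps.perm-refl EA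
        ; rg = λ j → retarget {f = g} (isSetoid-!⊗! EX EA) gm (RunSystem.root-lbl (Pj j)) (StarView.rf (K.d j (rj j)))
        ; rf = UnrollView.rf dd }
      fam : (q : Idx as★) → RunSystem X A fg (lab as★ q)
      fam (j , i) = K.gfRunAt j (rj j , i)
      GG = Graft.G EX EA {f = fg} {b = a} xs★ as★ ok★ fam
      S1 = ΣM (Idx as★) (cnt as★) (λ q → K.gfLeaves (proj₁ q) (rj (proj₁ q) , proj₂ q))
      S2 = ΣM (Idx V) (cnt V) (λ j → ΣM (K.I j (rj j)) (K.cI j (rj j)) (λ i → K.gfLeaves j (rj j , i)))
      e1 : Perm X (runLeaves GG (inj₁ tt)) (xs★ ⊕ S1)
      e1 = Graft.graft-leaves EX EA {f = fg} {b = a} xs★ as★ ok★ fam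
      e2 : Perm X (xs★ ⊕ S1) ((u ⊕ ΣM (Idx V) (cnt V) x) ⊕ S2)
      e2 = Lift-⊕ MX.perm-refl (ΣM-assoc (≈-refl-at EX) {I = Idx V} {c = cnt V} {J = λ j → K.I j (rj j)} {d = λ j → K.cI j (rj j)}
                           {F = λ q → K.gfLeaves (proj₁ q) (rj (proj₁ q) , proj₂ q)})
      e3 : Perm X ((u ⊕ ΣM (Idx V) (cnt V) x) ⊕ S2) (u ⊕ (ΣM (Idx V) (cnt V) x ⊕ S2))
      e3 = ⊕-assoc (≈-refl-at EX) {u = u} {v = ΣM (Idx V) (cnt V) x} {w = S2}
      e4 : Perm X (u ⊕ (ΣM (Idx V) (cnt V) x ⊕ S2)) (u ⊕ ΣM (Idx V) (cnt V) (λ j → K.tgtM j (rj j)))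
      e4 = Lift-⊕ MX.perm-refl (MX.perm-sym (ΣM-⊕ (≈-refl-at EX) {I = Idx V} {c = cnt V} {F = x}
                                 {G = λ j → ΣM (K.I j (rj j)) (K.cI j (rj j)) (λ i → K.gfLeaves j (rj j , i))}))
      e5 : Perm X (u ⊕ ΣM (Idx V) (cnt V) (λ j → K.tgtM j (rj j))) (u ⊕ ΣM (Idx V) (cnt V) (λ j → lab W (from τ j)))
      e5 = Lift-⊕ MX.perm-refl (Lift-ΣM′ {c = cnt V} {F = λ j → K.tgtM j (rj j)} {G = λ j → lab W (from τ j)}
                         (λ j → MX.perm-sym {runLeaves (Pj j) (rj j)} {K.tgtM j (rj j)} (K.convLv j (rj j)) MX.■ MX.perm-sym {lab W (from τ j)} {runLeaves (Pj j) (rj j)} (proj₂ (cj j))))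
      e6 : Perm X (u ⊕ ΣM (Idx V) (cnt V) (λ j → lab W (from τ j))) w
      e6 = Lift-⊕ MX.perm-refl (MX.perm-sym {ΣM (Idx W) (cnt W) (lab W)} {ΣM (Idx V) (cnt V) (λ j → lab W (from τ j))}
                         (ΣM-reidx (≈-refl-at EX) {c = cnt W} {d = cnt V} τ (lab W)))
           MX.■ MX.perm-sym {w} {u ⊕ ⨁ W} (UnrollView.ew dd)
      e : Perm X w (runLeaves GG (inj₁ tt))
      e = MX.perm-sym {runLeaves GG (inj₁ tt)} {w} (e1 MX.■ e2 MX.■ e3 MX.■ e4 MX.■ e5 MX.■ e6)

module Split (St : Set) (AI : St → Set) (sub : ∀ s → AI s → St) (XI XI1 XI2 : St → Set)
             (φ : ∀ s → XI s ↔ (XI1 s ⊎ XI2 s)) where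
  P : PathSystem
  P = record { St = St ; XI = XI ; AI = AI ; sub = sub }
  P1 : PathSystem
  P1 = record { St = St ; XI = XI1 ; AI = AI ; sub = sub }
  P2 : PathSystem
  P2 = record { St = St ; XI = XI2 ; AI = AI ; sub = sub }

  hx : ∀ {s} → XI1 s ⊎ XI2 s → Path P1 s ⊎ Path P2 s
  hx (inj₁ y) = inj₁ (here y)
  hx (inj₂ z) = inj₂ (here z)
  sto : ∀ {s} → Path P s → Path P1 s ⊎ Path P2 s
  sto (here {s} x) = hx (to (φ s) x)
  sto (there i l) = Sum.map (there i) (there i) (sto l)
  sfr : ∀ {s} → Path P1 s ⊎ Path P2 s → Path P s
  sfr (inj₁ (here {s} y)) = here (from (φ s) (inj₁ y))
  sfr (inj₁ (there i l)) = there i (sfr (inj₁ l))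
  sfr (inj₂ (here {s} z)) = here (from (φ s) (inj₂ z))
  sfr (inj₂ (there i l)) = there i (sfr (inj₂ l))
  stf : ∀ {s} (z : Path P1 s ⊎ Path P2 s) → sto (sfr z) ≡ z
  stf (inj₁ (here {s} y)) = cong hx (strictlyInverseˡ (φ s) (inj₁ y))
  stf (inj₁ (there i l)) = cong (Sum.map (there i) (there i)) (stf (inj₁ l))
  stf (inj₂ (here {s} z)) = cong hx (strictlyInverseˡ (φ s) (inj₂ z))
  stf (inj₂ (there i l)) = cong (Sum.map (there i) (there i)) (stf (inj₂ l))
  sfr-hx : ∀ {s} (z : XI1 s ⊎ XI2 s) → sfr (hx z) ≡ here (from (φ s) z)
  sfr-hx (inj₁ y) = refl
  sfr-hx (inj₂ z) = refl
  sfr-map : ∀ {s} (i : AI s) (z : Path P1 (sub s i) ⊎ Path P2 (sub s i)) → sfr (Sum.map (there i) (there i) z) ≡ there i (sfr z)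
  sfr-map i (inj₁ l) = refl
  sfr-map i (inj₂ l) = refl
  sft : ∀ {s} (l : Path P s) → sfr (sto l) ≡ l
  sft (here {s} x) = trans (sfr-hx (to (φ s) x)) (cong here (strictlyInverseʳ (φ s) x))
  sft (there i l) = trans (sfr-map i (sto l)) (cong (there i) (sft l))

  module _ {C : Set₁} {Rr : C → C → Set₁} (lX : ∀ s → XI s → C) (l1 : ∀ s → XI1 s → C) (l2 : ∀ s → XI2 s → C)
           (h : ∀ s x → Rr (lX s x) ([ l1 s , l2 s ]′ (to (φ s) x))) where
    lP1 : ∀ {s} → Path P1 s → C
    lP1 l = l1 (proj₁ (endpoint P1 l)) (proj₂ (endpoint P1 l))
    lP2 : ∀ {s} → Path P2 s → C
    lP2 l = l2 (proj₁ (endpoint P2 l)) (proj₂ (endpoint P2 l))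
    hx-lab : ∀ {s} (z : XI1 s ⊎ XI2 s) → [ lP1 , lP2 ]′ (hx z) ≡ [ l1 s , l2 s ]′ z
    hx-lab (inj₁ y) = refl
    hx-lab (inj₂ z) = refl
    map-lab : ∀ {s} (i : AI s) (z : Path P1 (sub s i) ⊎ Path P2 (sub s i)) →
              [ lP1 , lP2 ]′ (Sum.map (there i) (there i) z) ≡ [ lP1 , lP2 ]′ z
    map-lab i (inj₁ l) = refl
    map-lab i (inj₂ l) = refl
    slab : ∀ {s} (l : Path P s) → Rr (lX (proj₁ (endpoint P l)) (proj₂ (endpoint P l))) ([ lP1 , lP2 ]′ (sto l))
    slab (here {s} x) = subst (Rr (lX s x)) (sym (hx-lab (to (φ s) x))) (h s x)
    slab (there i l) = subst (Rr (lX (proj₁ (endpoint P l)) (proj₂ (endpoint P l)))) (sym (map-lab i (sto l))) (slab l)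
    split : ∀ s (c : Countable (Path P s)) (c1 : Countable (Path P1 s)) (c2 : Countable (Path P2 s)) →
            Lift Rr (mset (Path P s) c (λ l → lX (proj₁ (endpoint P l)) (proj₂ (endpoint P l))))
                    (mset (Path P1 s) c1 lP1 ⊕ mset (Path P2 s) c2 lP2)
    split s c c1 c2 = mk↔ₛ′ sto sfr stf sft , slab

module CoLaw4 {X A : Obj} (EX : IsSetoid X) (EA : IsSetoid A) (f : Hom ((! X ⊗ ! A) ⊗ ! A) A) (fm : IsMor f) where
  EXA = isSetoid-& EX EA
  fInner = uncurryArg X A f
  fDiag = diagArg X A f
  fNested = Ycoind (X & A) A fInner ∘ₕ m X A
  module MX = PermProps EX
  module MA = PermProps EA
  module MXA = PermProps EXA

  uncurryArg-mor : IsMor fInner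
  uncurryArg-mor {w , v} {w' , v'} {b} {b'} (ew , ev) eb r' =
    uncurryArg-intro EX EA {f = f} {w'} {v'} {b'} {UncurryView.ux d} {UncurryView.ua d}
      (fm {(UncurryView.ux d , UncurryView.ua d) , v} {(UncurryView.ux d , UncurryView.ua d) , v'} {b} {b'}
          (≈-refl (isSetoid-!⊗! EX EA) {UncurryView.ux d , UncurryView.ua d} , ev) eb (UncurryView.rf d))
      (MXA.perm-sym (Σ⇒Lift {R = _≈_ (X & A)} {w} {w'} ew) MXA.■ UncurryView.ew d)
    where d = uncurryArg-elim EX EA {f = f} fm {w} {v} {b} r'

  diagArg-mor : IsMor fDiag
  diagArg-mor {u , v} {u' , v'} {b} {b'} (eu , ev) eb r' =
    diagArg-intro EX EA {f = f} {u'} {v'} {b'} {DiagView.v1 d} {DiagView.v2 d}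
      (fm {(u , DiagView.v1 d) , DiagView.v2 d} {(u' , DiagView.v1 d) , DiagView.v2 d} {b} {b'}
          ((eu , ≈-refl (isSetoid-! EA) {DiagView.v1 d}) , ≈-refl (isSetoid-! EA) {DiagView.v2 d}) eb (DiagView.rf d))
      (MA.perm-sym (Σ⇒Lift {R = _≈_ A} {v} {v'} ev) MA.■ DiagView.ev d)
    where d = diagArg-elim EX EA {f = f} fm {u} {v} {b} r'

  fNested-mor : IsMor fNested
  fNested-mor {u , v} {u' , v'} {b} {b'} (eu , ev) eb (w' , mp , y) =
    w' , Lift⇒Σ {R = _≈_ (X & A)} {w'} {inl {X} {A} u' ⊕ inr {X} {A} v'}
           (Σ⇒Lift {R = _≈_ (X & A)} {w'} {inl {X} {A} u ⊕ inr {X} {A} v} mp MXA.■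
            Lift-⊕ (bij (Σ⇒Lift {R = _≈_ X} {u} {u'} eu) , lbl (Σ⇒Lift {R = _≈_ X} {u} {u'} eu))
                (bij (Σ⇒Lift {R = _≈_ A} {v} {v'} ev) , lbl (Σ⇒Lift {R = _≈_ A} {v} {v'} ev))) ,
    co-mor EXA EA fInner (λ {p} {p'} {q} {q'} → uncurryArg-mor {p} {p'} {q} {q'}) {w'} {w'} {b} {b'} (≈-refl (isSetoid-! EXA) {w'}) eb y

  module FromDiag {a : Car A} (C : RunSystem X A fDiag a) where
    module C = RunSystem C
    opaque
      dd : ∀ t → DiagView EX EA {f = f} (C.xs t) (C.as t) (C.lb t)
      dd t = diagArg-elim EX EA {f = f} fm {C.xs t} {C.as t} {C.lb t} (C.ok t)
    v1 = λ t → DiagView.v1 (dd t)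
    v2 = λ t → DiagView.v2 (dd t)
    β : ∀ t → Idx (C.as t) ↔ (Idx (v1 t) ⊎ Idx (v2 t))
    β t = bij (DiagView.ev (dd t))
    subC' : ∀ t → Idx (v1 t) ⊎ Idx (v2 t) → C.St
    subC' t z = C.sub t (from (β t) z)
    xsI : C.St → MSet (Car (X & A))
    xsI q = inl {X} {A} (C.xs q) ⊕ inr {X} {A} (v1 q)
    subI : ∀ q → Idx (v2 q) → C.St
    subI q k = subC' q (inj₂ k)
    Inner : ∀ t → RunSystem (X & A) A fInner (C.lb t)
    Inner t = record { St = C.St ; root = t ; lb = C.lb ; xs = xsI ; as = v2
                     ; ok = λ q → uncurryArg-intro EX EA {f = f} {xsI q} {v2 q} {C.lb q} {C.xs q} {v1 q} (DiagView.rf (dd q)) MXA.perm-refl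
                     ; sub = subI
                     ; sub-lbl = λ q k → ≈-trans EA (C.sub-lbl q (from (β q) (inj₂ k))) (Lift-from (DiagView.ev (dd q)) (inj₂ k))
                     ; root-lbl = ≈-refl EA }
    module SP = Split C.St (λ q → Idx (v2 q)) subI (λ q → Idx (xsI q)) (λ q → Idx (C.xs q)) (λ q → Idx (v1 q)) (λ q → ↔-refl)
    l1 : ∀ q → Idx (C.xs q) → Car (X & A)
    l1 q y = inj₁ (lab (C.xs q) y)
    l2 : ∀ q → Idx (v1 q) → Car (X & A)
    l2 q z = inj₂ (lab (v1 q) z)
    cX = countable-Path SP.P1 (λ q → cnt (C.xs q)) (λ q → cnt (v2 q))
    cA = countable-Path SP.P2 (λ q → cnt (v1 q)) (λ q → cnt (v2 q))
    LXI : C.St → MSet (Car X)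
    LXI t = mset (Path SP.P1 t) (cX t) (λ l → lab (C.xs (proj₁ (endpoint SP.P1 l))) (proj₂ (endpoint SP.P1 l)))
    LAI : C.St → MSet (Car A)
    LAI t = mset (Path SP.P2 t) (cA t) (λ l → lab (v1 (proj₁ (endpoint SP.P2 l))) (proj₂ (endpoint SP.P2 l)))
    hsp : ∀ q (x : Idx (xsI q)) → sumEq X A (lab (xsI q) x) ([ l1 q , l2 q ]′ x)
    hsp q (inj₁ y) = ≈-refl EX
    hsp q (inj₂ z) = ≈-refl EA
    spl : ∀ t → Perm (X & A) (runLeaves (Inner t) t) (inl {X} {A} (LXI t) ⊕ inr {X} {A} (LAI t))
    spl t = SP.split {Rr = sumEq X A} (λ q → lab (xsI q)) l1 l2 hsp t
              (countable-Path (pathSystem (Inner t)) (λ q → cnt (xsI q)) (λ q → cnt (v2 q)) t) (cX t) (cA t)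
    sO : ∀ t → Path SP.P2 t → C.St
    sO t λ' = subC' (proj₁ (endpoint SP.P2 λ')) (inj₁ (proj₂ (endpoint SP.P2 λ')))
    okO : ∀ t → R fNested (LXI t , LAI t) (C.lb t)
    okO t = runLeaves (Inner t) t ,
            Lift⇒Σ {R = _≈_ (X & A)} {runLeaves (Inner t) t} {inl {X} {A} (LXI t) ⊕ inr {X} {A} (LAI t)} (spl t) ,
            CoTreeRun.run⇒Ycoind EXA EA {f = fInner} (λ {p} {p'} {q} {q'} → uncurryArg-mor {p} {p'} {q} {q'}) {runLeaves (Inner t) t} {C.lb t} (Inner t , MXA.perm-refl)
    O : RunSystem X A fNested a
    O = record { St = C.St ; root = C.root ; lb = C.lb ; xs = LXI ; as = LAI ; ok = okO ; sub = sO
               ; sub-lbl = λ t λ' → ≈-trans EA (C.sub-lbl (proj₁ (endpoint SP.P2 λ')) (from (β _) (inj₁ (proj₂ (endpoint SP.P2 λ')))))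
                                            (Lift-from (DiagView.ev (dd (proj₁ (endpoint SP.P2 λ')))) (inj₁ (proj₂ (endpoint SP.P2 λ'))))
               ; root-lbl = C.root-lbl }
    module RI = Reidx C.St (λ t → Idx (C.xs t)) (λ t → Idx (C.xs t)) (λ t → Idx (C.as t)) (λ t → Idx (v1 t) ⊎ Idx (v2 t))
                      (λ t → ↔-refl) (λ t → ↔-sym (β t)) C.sub
    PC = RI.P'
    norm : ∀ t → Perm X (mset (Path PC t) (countable-Path PC (λ t → cnt (C.xs t)) (λ t → countable-⊎ (cnt (v1 t)) (cnt (v2 t))) t)
                              (λ l → lab (C.xs (proj₁ (endpoint PC l))) (proj₂ (endpoint PC l)))) (runLeaves C t)
    norm t = RI.reidx {Rr = _≈_ X} (λ t → lab (C.xs t)) (λ t → lab (C.xs t)) (λ t x → ≈-refl EX) t _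
               (countable-Path (pathSystem C) (λ t → cnt (C.xs t)) (λ t → cnt (C.as t)) t)
    OP = pathSystem O
    embX : ∀ {t} → Path SP.P1 t → Path PC t
    embX (here x) = here x
    embX (there k l) = there (inj₂ k) (embX l)
    embA : ∀ {t} (l : Path SP.P2 t) → Path PC (sO t l) → Path PC t
    embA (here m) c' = there (inj₁ m) c'
    embA (there k l) c' = there (inj₂ k) (embA l c')
    o2c : ∀ {t} → Path OP t → Path PC t
    o2c (here lx) = embX lx
    o2c (there la o) = embA la (o2c o)
    prep : ∀ {t} (k : Idx (v2 t)) → Path OP (subI t k) → Path OP t
    prep k (here lx) = here (there k lx)
    prep k (there la o) = there (there k la) o
    c2o : ∀ {t} → Path PC t → Path OP t
    c2o (here x) = here (here x)
    c2o (there (inj₁ m) l) = there (here m) (c2o l)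
    c2o (there (inj₂ k) l) = prep k (c2o l)
    c2o-embX : ∀ {t} (l : Path SP.P1 t) → c2o (embX l) ≡ here l
    c2o-embX (here x) = refl
    c2o-embX (there k l) = cong (prep k) (c2o-embX l)
    c2o-embA : ∀ {t} (l : Path SP.P2 t) (c' : Path PC (sO t l)) → c2o (embA l c') ≡ there l (c2o c')
    c2o-embA (here m) c' = refl
    c2o-embA (there k l) c' = cong (prep k) (c2o-embA l c')
    co : ∀ {t} (o : Path OP t) → c2o (o2c o) ≡ o
    co (here lx) = c2o-embX lx
    co (there la o) = trans (c2o-embA la (o2c o)) (cong (there la) (co o))
    o2c-prep : ∀ {t} (k : Idx (v2 t)) (o : Path OP (subI t k)) → o2c (prep k o) ≡ there (inj₂ k) (o2c o)
    o2c-prep k (here lx) = refl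
    o2c-prep k (there la o) = refl
    oc : ∀ {t} (l : Path PC t) → o2c (c2o l) ≡ l
    oc (here x) = refl
    oc (there (inj₁ m) l) = cong (there (inj₁ m)) (oc l)
    oc (there (inj₂ k) l) = trans (o2c-prep k (c2o l)) (cong (there (inj₂ k)) (oc l))
    labX : ∀ {t} (l : Path SP.P1 t) → lab (C.xs (proj₁ (endpoint PC (embX l)))) (proj₂ (endpoint PC (embX l))) ≡ lab (LXI t) l
    labX (here x) = refl
    labX (there k l) = labX l
    labA : ∀ {t} (l : Path SP.P2 t) (c' : Path PC (sO t l)) →
           lab (C.xs (proj₁ (endpoint PC (embA l c')))) (proj₂ (endpoint PC (embA l c'))) ≡ lab (C.xs (proj₁ (endpoint PC c'))) (proj₂ (endpoint PC c'))
    labA (here m) c' = refl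
    labA (there k l) c' = labA l c'
    olab : ∀ {t} (o : Path OP t) → lab (C.xs (proj₁ (endpoint PC (o2c o)))) (proj₂ (endpoint PC (o2c o))) ≡ lab (runLeaves O t) o
    olab (here lx) = labX lx
    olab (there la o) = trans (labA la (o2c o)) (olab o)
    oiso : ∀ t → Perm X (runLeaves O t) (mset (Path PC t) (countable-Path PC (λ t → cnt (C.xs t)) (λ t → countable-⊎ (cnt (v1 t)) (cnt (v2 t))) t)
                              (λ l → lab (C.xs (proj₁ (endpoint PC l))) (proj₂ (endpoint PC l))))
    oiso t = Lift-reindex (≈-refl-at EX) (mk↔ₛ′ o2c c2o oc co) olab

  diag⇒nested : ∀ {w a} → YcoindRun X A fDiag w a → YcoindRun X A fNested w a
  diag⇒nested (C , e) = FromDiag.O C , (e MX.■ MX.perm-sym (FromDiag.oiso C (RunSystem.root C) MX.■ FromDiag.norm C (RunSystem.root C)))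

  module ToDiag {a : Car A} (O : RunSystem X A fNested a) where
    module O = RunSystem O
    opaque
      inn : ∀ s → YcoindRun (X & A) A fInner (proj₁ (O.ok s)) (O.lb s)
      inn s = CoTreeRun.Ycoind⇒run EXA EA {f = fInner} {proj₁ (O.ok s)} {O.lb s} (proj₂ (proj₂ (O.ok s)))
    I : ∀ s → RunSystem (X & A) A fInner (O.lb s)
    I s = proj₁ (inn s)
    module Is (s : O.St) = RunSystem (I s)
    opaque
      dq : ∀ s q → UncurryView EX EA {f = f} (Is.xs s q) (Is.as s q) (Is.lb s q)
      dq s q = uncurryArg-elim EX EA {f = f} fm {Is.xs s q} {Is.as s q} {Is.lb s q} (Is.ok s q)
    ux = λ s q → UncurryView.ux (dq s q)
    ua = λ s q → UncurryView.ua (dq s q)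
    module SP (s : O.St) = Split (Is.St s) (λ q → Idx (Is.as s q)) (Is.sub s) (λ q → Idx (Is.xs s q))
                                 (λ q → Idx (ux s q)) (λ q → Idx (ua s q)) (λ q → bij (UncurryView.ew (dq s q)))
    LX : O.St → MSet (Car X)
    LX s = mset (Path (SP.P1 s) (Is.root s)) (countable-Path (SP.P1 s) (λ q → cnt (ux s q)) (λ q → cnt (Is.as s q)) (Is.root s))
               (λ l → lab (ux s (proj₁ (endpoint (SP.P1 s) l))) (proj₂ (endpoint (SP.P1 s) l)))
    LA : O.St → MSet (Car A)
    LA s = mset (Path (SP.P2 s) (Is.root s)) (countable-Path (SP.P2 s) (λ q → cnt (ua s q)) (λ q → cnt (Is.as s q)) (Is.root s))
               (λ l → lab (ua s (proj₁ (endpoint (SP.P2 s) l))) (proj₂ (endpoint (SP.P2 s) l)))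
    spl : ∀ s → Perm (X & A) (runLeaves (I s) (Is.root s)) (inl {X} {A} (LX s) ⊕ inr {X} {A} (LA s))
    spl s = SP.split s {Rr = sumEq X A} (λ q → lab (Is.xs s q)) (λ q y → inj₁ (lab (ux s q) y)) (λ q z → inj₂ (lab (ua s q) z))
              (λ q x → lbl (UncurryView.ew (dq s q)) x) (Is.root s)
              (countable-Path (pathSystem (I s)) (λ q → cnt (Is.xs s q)) (λ q → cnt (Is.as s q)) (Is.root s)) _ _
    PP : ∀ s → Perm (X & A) (inl {X} {A} (O.xs s) ⊕ inr {X} {A} (O.as s)) (inl {X} {A} (LX s) ⊕ inr {X} {A} (LA s))
    PP s = MXA.perm-sym (Σ⇒Lift {R = _≈_ (X & A)} {proj₁ (O.ok s)} {inl {X} {A} (O.xs s) ⊕ inr {X} {A} (O.as s)} (proj₁ (proj₂ (O.ok s))))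
           MXA.■ proj₂ (inn s) MXA.■ spl s
    opaque
      cc : ∀ s → Perm X (O.xs s) (LX s) × Perm A (O.as s) (LA s)
      cc s = cancel-inl⊕inr EX EA (PP s)
    β : ∀ s → Idx (O.as s) ↔ Path (SP.P2 s) (Is.root s)
    β s = bij (proj₂ (cc s))
    module RI = Reidx O.St (λ s → Idx (O.xs s)) (λ s → Path (SP.P1 s) (Is.root s)) (λ s → Idx (O.as s)) (λ s → Path (SP.P2 s) (Is.root s))
                      (λ s → ↔-sym (bij (proj₁ (cc s)))) (λ s → ↔-sym (β s)) O.sub
    PO = RI.P'
    norm : ∀ s → Perm X (mset (Path PO s) (countable-Path PO (λ s → cnt (LX s)) (λ s → cnt (LA s)) s)
                           (λ l → lab (LX (proj₁ (endpoint PO l))) (proj₂ (endpoint PO l)))) (runLeaves O s)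
    norm s = RI.reidx {Rr = _≈_ X} (λ s → lab (O.xs s)) (λ s → lab (LX s)) (λ s x → ≈-sym EX (Lift-from (proj₁ (cc s)) x)) s _
               (countable-Path (pathSystem O) (λ s → cnt (O.xs s)) (λ s → cnt (O.as s)) s)
    module PF (s : O.St) = Prefix (SP.P2 s) (Is.root s)
    StC = Σ O.St (λ s → Σ (Is.St s) (PF.Pre s))
    nxt : ∀ s {q} → PF.Pre s q → Idx (ua s q) → O.St
    nxt s π k = O.sub s (from (β s) (PF.cat s π (here k)))
    lbC : StC → Car A
    lbC (s , q , π) = Is.lb s q
    xsC : StC → MSet (Car X)
    xsC (s , q , π) = ux s q
    asC : StC → MSet (Car A)
    asC (s , q , π) = ua s q ⊕ Is.as s q
    okC : ∀ p → R fDiag (xsC p , asC p) (lbC p)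
    okC (s , q , π) = diagArg-intro EX EA {f = f} {ux s q} {ua s q ⊕ Is.as s q} {Is.lb s q} {ua s q} {Is.as s q} (UncurryView.rf (dq s q)) MA.perm-refl
    subC : ∀ p → Idx (asC p) → StC
    subC (s , q , π) (inj₁ k) = nxt s π k , Is.root (nxt s π k) , PF.start
    subC (s , q , π) (inj₂ i) = s , Is.sub s q i , PF.step π i
    slC : ∀ p i → _≈_ A (lbC (subC p i)) (lab (asC p) i)
    slC (s , q , π) (inj₂ i) = Is.sub-lbl s q i
    slC (s , q , π) (inj₁ k) =
      ≈-trans EA (Is.root-lbl (nxt s π k)) (≈-trans EA (O.sub-lbl s (from (β s) (PF.cat s π (here k))))
        (subst (λ p → _≈_ A (lab (O.as s) (from (β s) (PF.cat s π (here k)))) (lab (ua s (proj₁ p)) (proj₂ p)))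
               (PF.cat-end s π (here k)) (Lift-from (proj₂ (cc s)) (PF.cat s π (here k)))))
    C : RunSystem X A fDiag a
    C = record { St = StC ; root = O.root , Is.root O.root , PF.start ; lb = lbC ; xs = xsC ; as = asC ; ok = okC
               ; sub = subC ; sub-lbl = slC ; root-lbl = ≈-trans EA (Is.root-lbl O.root) O.root-lbl }
    CP = pathSystem C
    Cut : ∀ s q → PF.Pre s q → Set
    Cut s q π = Path (SP.P1 s) q ⊎ Σ (Path (SP.P2 s) q) (λ la → Path PO (O.sub s (from (β s) (PF.cat s π la))))
    mapH : ∀ {s q π} (i : Idx (Is.as s q)) → Cut s (Is.sub s q i) (PF.step π i) → Cut s q π
    mapH i (inj₁ lx) = inj₁ (there i lx)
    mapH i (inj₂ (la , o)) = inj₂ (there i la , o)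
    c2oH : ∀ {s} → Cut s (Is.root s) PF.start → Path PO s
    c2oH (inj₁ lx) = here lx
    c2oH (inj₂ (la , o)) = there la o
    h : ∀ {s q π} → Path CP (s , q , π) → Cut s q π
    c2o : ∀ {s} → Path CP (s , Is.root s , PF.start) → Path PO s
    h (here x) = inj₁ (here x)
    h {s} {q} {π} (there (inj₂ i) l) = mapH {s} {q} {π} i (h {s} {Is.sub s q i} {PF.step π i} l)
    h (there (inj₁ k) l) = inj₂ (here k , c2o l)
    c2o {s} l = c2oH {s} (h {s} {Is.root s} {PF.start} l)
    embX : ∀ {s q π} → Path (SP.P1 s) q → Path CP (s , q , π)
    embX (here x) = here x
    embX (there i l) = there (inj₂ i) (embX l)
    embA : ∀ {s q π} (la : Path (SP.P2 s) q) → Path CP (O.sub s (from (β s) (PF.cat s π la)) , _ , PF.start) → Path CP (s , q , π)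
    embA (here k) c' = there (inj₁ k) c'
    embA (there i la) c' = there (inj₂ i) (embA la c')
    o2c : ∀ {s} → Path PO s → Path CP (s , Is.root s , PF.start)
    o2c (here lx) = embX lx
    o2c (there la o) = embA la (o2c o)
    hinv : ∀ {s q π} → Cut s q π → Path CP (s , q , π)
    hinv (inj₁ lx) = embX lx
    hinv (inj₂ (la , o)) = embA la (o2c o)
    hX : ∀ {s q π} (lx : Path (SP.P1 s) q) → h {s} {q} {π} (embX lx) ≡ inj₁ lx
    hX (here x) = refl
    hX {s} {q} {π} (there i lx) = cong (mapH {s} {q} {π} i) (hX {s} {Is.sub s q i} {PF.step π i} lx)
    hA : ∀ {s q π} (la : Path (SP.P2 s) q) c' → h {s} {q} {π} (embA la c') ≡ inj₂ (la , c2o c')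
    hA (here k) c' = refl
    hA {s} {q} {π} (there i la) c' = cong (mapH {s} {q} {π} i) (hA {s} {Is.sub s q i} {PF.step π i} la c')
    co : ∀ {s} (o : Path PO s) → c2o (o2c o) ≡ o
    co {s} (here lx) = cong (c2oH {s}) (hX {s} {Is.root s} {PF.start} lx)
    co {s} (there la o) = trans (cong (c2oH {s}) (hA {s} {Is.root s} {PF.start} la (o2c o))) (cong (there la) (co o))
    hinv-map : ∀ {s q π} (i : Idx (Is.as s q)) (z : Cut s (Is.sub s q i) (PF.step π i)) →
               hinv {s} {q} {π} (mapH {s} {q} {π} i z) ≡ there (inj₂ i) (hinv {s} {Is.sub s q i} {PF.step π i} z)
    hinv-map i (inj₁ lx) = refl
    hinv-map i (inj₂ (la , o)) = refl
    o2c-H : ∀ {s} (z : Cut s (Is.root s) PF.start) → o2c (c2oH {s} z) ≡ hinv {s} {Is.root s} {PF.start} z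
    o2c-H (inj₁ lx) = refl
    o2c-H (inj₂ (la , o)) = refl
    hh : ∀ {s q π} (l : Path CP (s , q , π)) → hinv {s} {q} {π} (h {s} {q} {π} l) ≡ l
    oc : ∀ {s} (l : Path CP (s , Is.root s , PF.start)) → o2c (c2o l) ≡ l
    hh (here x) = refl
    hh {s} {q} {π} (there (inj₂ i) l) = trans (hinv-map {s} {q} {π} i (h {s} {Is.sub s q i} {PF.step π i} l)) (cong (there (inj₂ i)) (hh l))
    hh (there (inj₁ k) l) = cong (there (inj₁ k)) (oc l)
    oc {s} l = trans (o2c-H {s} (h {s} {Is.root s} {PF.start} l)) (hh l)
    labX : ∀ {s q π} (l : Path (SP.P1 s) q) →
           lab (xsC (proj₁ (endpoint CP (embX {s} {q} {π} l)))) (proj₂ (endpoint CP (embX {s} {q} {π} l))) ≡ lab (ux s (proj₁ (endpoint (SP.P1 s) l))) (proj₂ (endpoint (SP.P1 s) l))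
    labX (here x) = refl
    labX (there i l) = labX l
    labA : ∀ {s q π} (la : Path (SP.P2 s) q) c' →
           lab (xsC (proj₁ (endpoint CP (embA {s} {q} {π} la c')))) (proj₂ (endpoint CP (embA {s} {q} {π} la c'))) ≡ lab (xsC (proj₁ (endpoint CP c'))) (proj₂ (endpoint CP c'))
    labA (here k) c' = refl
    labA (there i la) c' = labA la c'
    olab : ∀ {s} (o : Path PO s) → lab (runLeaves C (s , Is.root s , PF.start)) (o2c o) ≡ lab (LX (proj₁ (endpoint PO o))) (proj₂ (endpoint PO o))
    olab (here lx) = labX lx
    olab (there la o) = trans (labA la (o2c o)) (olab o)
    oiso : ∀ s → Perm X (mset (Path PO s) (countable-Path PO (λ s → cnt (LX s)) (λ s → cnt (LA s)) s)
                            (λ l → lab (LX (proj₁ (endpoint PO l))) (proj₂ (endpoint PO l))))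
                      (runLeaves C (s , Is.root s , PF.start))
    oiso s = Lift-reindex (≈-refl-at EX) (mk↔ₛ′ o2c c2o oc co) olab

  nested⇒diag : ∀ {w a} → YcoindRun X A fNested w a → YcoindRun X A fDiag w a
  nested⇒diag (O , e) = ToDiag.C O , (e MX.■ MX.perm-sym (ToDiag.norm O (RunSystem.root O)) MX.■ ToDiag.oiso O (RunSystem.root O))

  co-law4 : Ycoind X A fNested ≐ Ycoind X A fDiag
  co-law4 w b = (λ y → CoTreeRun.run⇒Ycoind EX EA {f = fDiag} (λ {p} {p'} {q} {q'} → diagArg-mor {p} {p'} {q} {q'}) {w} {b}
                          (nested⇒diag (CoTreeRun.Ycoind⇒run EX EA {f = fNested} {w} {b} y))) ,
                (λ y → CoTreeRun.run⇒Ycoind EX EA {f = fNested} (λ {p} {p'} {q} {q'} → fNested-mor {p} {p'} {q} {q'}) {w} {b}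
                          (diag⇒nested (CoTreeRun.Ycoind⇒run EX EA {f = fDiag} {w} {b} y)))

Yind-isConway : IsConway Yind
Yind-isConway = record
  { preserves-mor = λ X A f fm {a} {a'} {b} {b'} → ind-mor (isSetoid-small X) (isSetoid-small A) f fm {a} {a'} {b} {b'}
  ; preserves-eq = λ X A f f' fm fm' e → ind-eq (isSetoid-small X) f f' e
  ; law1 = λ X Z A g f gm fm → ind-law1 (isSetoid-small X) (isSetoid-small Z) (isSetoid-small A) g f gm fm
  ; law2 = λ X A f fm → ind-law2 (isSetoid-small X) (isSetoid-small A) f
  ; law3 = λ X A B f g fm gm → ind-law3 (isSetoid-small X) (isSetoid-small A) (isSetoid-small B) f g fm gm
  ; law4 = λ X A f fm → IndLaw4.ind-law4 (isSetoid-small X) (isSetoid-small A) f fm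
  }

Ycoind-isConway : IsConway Ycoind
Ycoind-isConway = record
  { preserves-mor = λ X A f fm {a} {a'} {b} {b'} → co-mor (isSetoid-small X) (isSetoid-small A) f fm {a} {a'} {b} {b'}
  ; preserves-eq = λ X A f f' fm fm' e → co-eq (isSetoid-small X) (isSetoid-small A) f f' fm fm' e
  ; law1 = λ X Z A g f gm fm → co-law1 (isSetoid-small X) (isSetoid-small Z) (isSetoid-small A) g f gm fm
  ; law2 = λ X A f fm → co-law2 (isSetoid-small X) (isSetoid-small A) f fm
  ; law3 = λ X A B f g fm gm → co-law3 (isSetoid-small X) (isSetoid-small A) (isSetoid-small B) f g fm gm
  ; law4 = λ X A f fm → CoLaw4.co-law4 (isSetoid-small X) (isSetoid-small A) f fm
  }

mainTheorem7 : IsConway Yind × IsConway Ycoind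
mainTheorem7 = Yind-isConway , Ycoind-isConway
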